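{- Let $k\ge1$ and $l_1,\dots,l_k\ge2$ be integers, and let $\mathcal{G}=\mathcal{G}_h(l_1,2,l_2,2,\dots,2,l_k)$. Let $\mathcal{T}$ be a triangular snake graph of $\mathcal{G}$, obtained with either the standard or the opposite contraction convention, chosen so that each of the $k-1$ vertical chains $\{G_j,G_{j+1}\}$ contracts to an hourglass graph (i.e. the common edge of $G_j$ and $G_{j+1}$ is contracted). Let $M_{st}=(m_{ij})_{1\le i,j\le k}$ be the path matrix of $\mathcal{T}$ between its sources $s$ and sinks $t$. Then \[ m_{ij}=\begin{cases} \displaystyle F_{l_i+1}F_{l_j+1}\prod_{r=i+1}^{j-1}F_{l_r} & \text{if } i<j,\\ F_{l_i+2} & \text{if } i=j,\\ F_2 & \text{if } i=j+1,\\ F_0 & \text{otherwise}.\end{cases} \]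
   Context: $F_n$ is the $n$-th Fibonacci number ($F_0=0$, $F_1=1$, $F_{n+1}=F_n+F_{n-1}$). A snake graph is a sequence of unit-square tiles $G_1,\dots,G_d$ in $\mathbb{Z}^2$ (each a 4-cycle with north, south, east, west edges) with each $G_{i+1}$ immediately above (north edge of $G_i$ = south edge of $G_{i+1}$) or immediately to the right of $G_i$. A chain is a maximal set of consecutive tiles in one row (horizontal) or one column (vertical); consecutive chains share one tile. $\mathcal{G}_h(a_1,\dots,a_n)$ is the snake graph whose successive chains from $G_1$ have lengths $a_1,\dots,a_n$, the first horizontal and then alternating. Triangular snake graph: under the standard convention, for odd $i$ let $c_i$ be the north edge of $G_i$ and for even $i$ the south edge; under the opposite convention, for odd $i$ let $c_i$ be the south edge and for even $i$ the north edge. Contract each $c_i$ to a vertex $\mathbf{c}_i$ (with the $y$-coordinate of $c_i$) and orient the remaining edges: if $c_i$ is the north edge of $G_i$ and $a,b$ are the south-west and south-east corners, arrows $a\to b$, $a\to\mathbf{c}_i$ (west edge), $\mathbf{c}_i\to b$ (east edge); if $c_i$ is the south edge and $a,b$ are the north-west and north-east corners, arrows $a\to b$, $a\to\mathbf{c}_i$, $\mathbf{c}_i\to b$. An hourglass graph is the union of the triangles of two vertically adjacent tiles $G_j,G_{j+1}$ sharing the contracted vertex of their common edge. Sources/sinks (no incoming/outgoing arrows) are listed as $s=(s_1,\dots,s_k)$, $t=(t_1,\dots,t_k)$ by increasing $y$-coordinate; $m_{ij}$ is the number of directed paths from $s_i$ to $t_j$. -}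

module Defs where

open import Data.Bool using (_≟_; Bool; true; false; if_then_else_; _∧_; _∨_; not)
open import Data.Nat using (ℕ; zero; suc; _+_; _*_; _∸_; _≡ᵇ_; _<ᵇ_; _≤ᵇ_)
open import Data.Fin using (Fin; toℕ)
open import Data.Product using (_×_; _,_; proj₁; proj₂)
open import Data.List using (_++_; List; []; _∷_; map; concat; concatMap; intersperse;
  allFin; scanl; replicate; filter; length; deduplicateᵇ; foldr)
open import Data.Bool.ListAction using (any)
open import Data.Nat.ListAction using (sum; product)
open import Data.Maybe using (Maybe; just; nothing)
open import Relation.Binary.PropositionalEquality using (_≡_)

fib : ℕ → ℕ
fib zero = zero
fib (suc zero) = suc zero
fib (suc (suc n)) = fib (suc n) + fib n

-- Lattice points of ℤ² (the snake graph lives in the first quadrant,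
-- its first tile G₁ has south-west corner (0,0)).  A point is (x , y).

Point : Set
Point = ℕ × ℕ

_==ᵖ_ : Point → Point → Bool
(x , y) ==ᵖ (x' , y') = (x ≡ᵇ x') ∧ (y ≡ᵇ y')

_∈ᵇ_ : Point → List Point → Bool
p ∈ᵇ ps = any (λ q → q ==ᵖ p) ps

-- Snake graphs 𝒢_h(a₁,…,aₙ): chains of lengths a₁,…,aₙ, first horizontal,
-- then alternating; consecutive chains share one tile.

data Dir : Set where
  right up : Dir

chainSteps : Dir → List ℕ → List Dir
chainSteps d [] = []
chainSteps right (a ∷ as) = replicate (a ∸ 1) right ++ chainSteps up as
chainSteps up (a ∷ as) = replicate (a ∸ 1) up ++ chainSteps right as

-- steps of 𝒢_h(a₁,…,aₙ); the m-th step (0-based) goes from G_{m+1} to G_{m+2}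
snakeSteps : List ℕ → List Dir
snakeSteps = chainSteps right

move : Point → Dir → Point
move (x , y) right = (suc x , y)
move (x , y) up = (x , suc y)

-- south-west corners of the tiles G₁,…,G_d of 𝒢_h(a₁,…,aₙ)
snakeTiles : List ℕ → List Point
snakeTiles as = scanl move (0 , 0) (snakeSteps as)

hourglassChains : (k : ℕ) → (Fin k → ℕ) → List ℕ
hourglassChains k l = intersperse 2 (map l (allFin k))

-- Contraction conventions.  cNorth conv i = true iff c_i is the north
-- edge of G_i (i is 1-based).

data Convention : Set where
  standard opposite : Convention

isOdd : ℕ → Bool
isOdd zero = false
isOdd (suc n) = not (isOdd n)

cNorth : Convention → ℕ → Bool
cNorth standard i = isOdd i
cNorth opposite i = not (isOdd i)

_‼_ : {A : Set} → List A → ℕ → Maybe A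
[] ‼ n = nothing
(x ∷ xs) ‼ zero = just x
(x ∷ xs) ‼ suc n = xs ‼ n

-- Hypothesis: for every vertical step G_j → G_{j+1} (G_{j+1} immediately
-- above G_j) the common edge is contracted, i.e. c_j is the north edge of G_j.
-- (The m-th step, 0-based, is the step G_{m+1} → G_{m+2}.)
HourglassCompatible : Convention → List ℕ → Set
HourglassCompatible conv as =
  ∀ m → snakeSteps as ‼ m ≡ just up → cNorth conv (suc m) ≡ true

indexFrom : {A : Set} → ℕ → List A → List (ℕ × A)
indexFrom n [] = []
indexFrom n (x ∷ xs) = (n , x) ∷ indexFrom (suc n) xs

-- the contracted edges c_i, each a horizontal unit edge represented
-- by its west endpoint
contractedEdges : Convention → List Point → List Point
contractedEdges conv ts =
  map (λ { (i , (x , y)) → if cNorth conv i then (x , suc y) else (x , y) })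
      (indexFrom 1 ts)

-- Contracting the edges identifies the vertices of each maximal horizontal
-- run of contracted edges; we represent the resulting vertex by the
-- westmost point of the run (it keeps the y-coordinate).
repAux : List Point → ℕ → ℕ → Point
repAux cs zero y = (zero , y)
repAux cs (suc x) y = if (x , y) ∈ᵇ cs then repAux cs x y else (suc x , y)

rep : List Point → Point → Point
rep cs (x , y) = repAux cs x y

-- oriented (uncontracted) edges of the triangle of tile G_i, as pairs of
-- lattice points (tail , head), before identification.
triangleEdges : Convention → ℕ × Point → List (Point × Point)
triangleEdges conv (i , (x , y)) =
  if cNorth conv i
  then ((sw , se) ∷ (sw , nw) ∷ (ne , se) ∷ [])
  else ((nw , ne) ∷ (nw , sw) ∷ (se , ne) ∷ [])
  where
  sw = (x , y)
  se = (suc x , y)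
  nw = (x , suc y)
  ne = (suc x , suc y)

sameGeomEdge : Point × Point → Point × Point → Bool
sameGeomEdge (a , b) (c , d) = ((a ==ᵖ c) ∧ (b ==ᵖ d)) ∨ ((a ==ᵖ d) ∧ (b ==ᵖ c))

-- arrows of the triangular snake graph: each (uncontracted) edge of the
-- snake graph once (edges shared by two tiles are the same edge),
-- oriented as prescribed, with endpoints replaced by their contracted vertex.
arrows : Convention → List Point → List (Point × Point)
arrows conv ts =
  map (λ { (a , b) → (rep cs a , rep cs b) })
      (deduplicateᵇ sameGeomEdge (concatMap (triangleEdges conv) (indexFrom 1 ts)))
  where cs = contractedEdges conv ts

corners : Point → List Point
corners (x , y) = (x , y) ∷ (suc x , y) ∷ (x , suc y) ∷ (suc x , suc y) ∷ []

vertices : Convention → List Point → List Point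
vertices conv ts =
  deduplicateᵇ _==ᵖ_ (map (rep (contractedEdges conv ts)) (concatMap corners ts))

isSource : List (Point × Point) → Point → Bool
isSource es v = not (any (λ e → proj₂ e ==ᵖ v) es)

isSink : List (Point × Point) → Point → Bool
isSink es v = not (any (λ e → proj₁ e ==ᵖ v) es)

insertY : Point → List Point → List Point
insertY p [] = p ∷ []
insertY p (q ∷ qs) = if proj₂ q ≤ᵇ proj₂ p then q ∷ insertY p qs else p ∷ q ∷ qs

sortY : List Point → List Point
sortY = foldr insertY []

sources : Convention → List Point → List Point
sources conv ts = sortY (filter (λ v → isSource (arrows conv ts) v ≟ true) (vertices conv ts))

sinks : Convention → List Point → List Point
sinks conv ts = sortY (filter (λ v → isSink (arrows conv ts) v ≟ true) (vertices conv ts))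

-- number of directed (vertex-simple) paths from u to v, using the arrow list
-- es (parallel arrows give distinct paths); `fuel` bounds the number of
-- arrows, `vis` are the vertices already visited.
countPaths : List (Point × Point) → ℕ → List Point → Point → Point → ℕ
countPaths es fuel vis u v with u ==ᵖ v
... | true = 1
countPaths es zero vis u v | false = 0
countPaths es (suc fuel) vis u v | false =
  sum (map (λ e → if (proj₁ e ==ᵖ u) ∧ not (proj₂ e ∈ᵇ (u ∷ vis))
                  then countPaths es fuel (u ∷ vis) (proj₂ e) v else 0) es)

-- m_{st}: number of directed paths from s to t in the triangular snake graph
-- (a simple path uses fewer arrows than there are vertices)
numPaths : Convention → List Point → Point → Point → ℕ
numPaths conv ts s t = countPaths (arrows conv ts) (length (vertices conv ts)) [] s t

-- path matrix M_{st} (rows indexed by sources, columns by sinks, both by increasing y)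
pathMatrix : Convention → List Point → List (List ℕ)
pathMatrix conv ts =
  map (λ s → map (λ t → numPaths conv ts s t) (sinks conv ts)) (sources conv ts)

-- The claimed matrix (indices 0-based here: row i, column j ↔ m_{i+1,j+1}).

expectedEntry : (k : ℕ) → (Fin k → ℕ) → Fin k → Fin k → ℕ
expectedEntry k l i j =
  if toℕ i <ᵇ toℕ j
  then fib (l i + 1) * fib (l j + 1)
       * product (map (λ r → fib (l r))
                      (filter (λ r → (toℕ i <ᵇ toℕ r) ∧ (toℕ r <ᵇ toℕ j) ≟ true) (allFin k)))
  else if toℕ i ≡ᵇ toℕ j then fib (l i + 2)
  else if toℕ i ≡ᵇ suc (toℕ j) then fib 2
  else fib 0

expectedMatrix : (k : ℕ) → (Fin k → ℕ) → List (List ℕ)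
expectedMatrix k l = map (λ i → map (λ j → expectedEntry k l i j) (allFin k)) (allFin k)

-- Contracted edges alternate between north and south along the snake, so the triangles of a
-- horizontal chain of length l contract to a fan v₀, …, v_{l+1} with arcs v_t → v_{t+1} and
-- v_t → v_{t+2}; in it v_t reaches v_{l+1} along F_{l+2−t} paths and v_l along F_{l+1−t} paths.
-- Each vertical chain {G_j, G_{j+1}} contracts its common edge, which glues v_l of one fan to
-- v₁ of the next; the sources are the v₀ and the sinks the v_{l+1}.  A path from s_i to t_j
-- with i < j must pass the seams i, …, j − 1, giving F_{l_i+1} ∏ F_{l_r} F_{l_j+1} paths;
-- s_j reaches t_j along F_{l_j+2} paths, s_{j+1} reaches t_j only through the seam, and no other
-- source reaches t_j.  The height (first column of the row) + t of v_t increases strictly along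
-- arrows, so the path counts are the solution of the recursion over out-neighbours.

module Submission where

open import Defs
open import Data.Bool using (Bool; true; false; if_then_else_; _∧_; _∨_; not; T; T?)
open import Data.Bool.Properties using (not-involutive; ∨-identityʳ) renaming (_≟_ to _≟ᴮ_)
open import Data.Bool.ListAction using (any)
open import Data.Empty using (⊥-elim)
open import Data.Fin using (Fin; toℕ; fromℕ<) renaming (zero to fzero; suc to fsuc)
open import Data.Fin.Properties using (toℕ<n; toℕ-fromℕ<)
open import Data.List using (List; []; _∷_; _++_; [_]; map; concat; concatMap; applyUpTo; filter; filterᵇ;
  length; deduplicateᵇ; _ʳ++_; reverse; replicate; intersperse; scanl; tabulate; allFin)
open import Data.List.Properties using (++-assoc; ++-identityʳ; map-++; concat-map; concat-++; concat-concat;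
  map-cong; map-∘; map-tabulate; length-map; length-tabulate; length-applyUpTo; length-replicate;
  map-applyUpTo; applyUpTo-∷ʳ; filter-++; map-ʳ++)
open import Data.List.Membership.Propositional using (_∈_)
open import Data.List.Membership.Propositional.Properties using (∈-++⁺ʳ; ∈-concat⁺′; ∈-applyUpTo⁺; ∈-map⁺)
open import Data.List.Relation.Unary.All as All using (All; []; _∷_)
open import Data.List.Relation.Unary.All.Properties using (++⁺; concat⁺; map⁺)
open import Data.List.Relation.Unary.Any using (here; there)
open import Data.Maybe using (just)
open import Data.Nat using (ℕ; zero; suc; _+_; _*_; _∸_; _≡ᵇ_; _<ᵇ_; _≤ᵇ_; _≤_; _<_; _≤?_; _<?_; z≤n; s≤s)
open import Data.Nat.ListAction using (sum; product)
open import Data.Nat.ListAction.Properties using (sum-++)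
open import Data.Nat.Properties
open import Data.Nat.Tactic.RingSolver using (solve-∀)
open import Data.Product using (_×_; _,_; proj₁; proj₂; ∃-syntax)
open import Data.Sum using (_⊎_; inj₁; inj₂)
open import Data.Unit using (⊤; tt)
open import Function using (_∘_)
open import Relation.Binary.Definitions using (tri<; tri≈; tri>)
open import Relation.Binary.PropositionalEquality using (_≡_; _≢_; refl; sym; trans; cong; cong₂; subst; subst₂; module ≡-Reasoning)
open import Relation.Nullary using (¬_; Dec; yes; no; does)

private
  T⇒≡true : ∀ {b} → T b → b ≡ true
  T⇒≡true {true} _ = refl

  ≡true⇒T : ∀ {b} → b ≡ true → T b
  ≡true⇒T refl = tt

≡ᵇ-true : ∀ {m n} → m ≡ n → (m ≡ᵇ n) ≡ true
≡ᵇ-true {m} refl = T⇒≡true (≡⇒≡ᵇ m m refl)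

≡ᵇ-false : ∀ {m n} → m ≢ n → (m ≡ᵇ n) ≡ false
≡ᵇ-false {m} {n} m≢n with m ≡ᵇ n in eq
... | false = refl
... | true = ⊥-elim (m≢n (≡ᵇ⇒≡ m n (≡true⇒T eq)))

≡ᵇ-sound : ∀ {m n} → (m ≡ᵇ n) ≡ true → m ≡ n
≡ᵇ-sound {m} {n} eq = ≡ᵇ⇒≡ m n (≡true⇒T eq)

<ᵇ-true : ∀ {m n} → m < n → (m <ᵇ n) ≡ true
<ᵇ-true m<n = T⇒≡true (<⇒<ᵇ m<n)

<ᵇ-false : ∀ {m n} → ¬ m < n → (m <ᵇ n) ≡ false
<ᵇ-false {m} {n} m≮n with m <ᵇ n in eq
... | false = refl
... | true = ⊥-elim (m≮n (<ᵇ⇒< m n (≡true⇒T eq)))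

<ᵇ-sound : ∀ {m n} → (m <ᵇ n) ≡ true → m < n
<ᵇ-sound {m} {n} eq = <ᵇ⇒< m n (≡true⇒T eq)

≤ᵇ-true : ∀ {m n} → m ≤ n → (m ≤ᵇ n) ≡ true
≤ᵇ-true m≤n = T⇒≡true (≤⇒≤ᵇ m≤n)

≤ᵇ-false : ∀ {m n} → ¬ m ≤ n → (m ≤ᵇ n) ≡ false
≤ᵇ-false {m} {n} m≰n with m ≤ᵇ n in eq
... | false = refl
... | true = ⊥-elim (m≰n (≤ᵇ⇒≤ m n (≡true⇒T eq)))

n≢1+n : ∀ n → n ≢ suc n
n≢1+n n = 1+n≢n ∘ sym

n≢2+n : ∀ n → n ≢ suc (suc n)
n≢2+n zero ()
n≢2+n (suc n) eq = n≢2+n n (suc-injective eq)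

==ᵖ-sound : ∀ p q → (p ==ᵖ q) ≡ true → p ≡ q
==ᵖ-sound (a , b) (c , d) eq with a ≡ᵇ c in e₁ | b ≡ᵇ d in e₂
... | true | true = cong₂ _,_ (≡ᵇ-sound e₁) (≡ᵇ-sound e₂)

==ᵖ-refl : ∀ p → (p ==ᵖ p) ≡ true
==ᵖ-refl (a , b) rewrite ≡ᵇ-true {a} refl | ≡ᵇ-true {b} refl = refl

==ᵖ-false : ∀ p q → p ≢ q → (p ==ᵖ q) ≡ false
==ᵖ-false p q p≢q with p ==ᵖ q in eq
... | false = refl
... | true = ⊥-elim (p≢q (==ᵖ-sound p q eq))

applyUpTo-cong : ∀ {A : Set} {f g : ℕ → A} n → (∀ i → i < n → f i ≡ g i) → applyUpTo f n ≡ applyUpTo g n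
applyUpTo-cong zero f≡g = refl
applyUpTo-cong (suc n) f≡g = cong₂ _∷_ (f≡g 0 (s≤s z≤n)) (applyUpTo-cong n (λ i i<n → f≡g (suc i) (s≤s i<n)))

applyUpTo-+ : ∀ {A : Set} (f : ℕ → A) m n → applyUpTo f (m + n) ≡ applyUpTo f m ++ applyUpTo (λ i → f (m + i)) n
applyUpTo-+ f zero n = refl
applyUpTo-+ f (suc m) n = cong (f 0 ∷_) (applyUpTo-+ (f ∘ suc) m n)

All-applyUpTo : ∀ {A : Set} {P : A → Set} (f : ℕ → A) n → (∀ i → i < n → P (f i)) → All P (applyUpTo f n)
All-applyUpTo f zero _ = []
All-applyUpTo f (suc n) h = h 0 (s≤s z≤n) ∷ All-applyUpTo (f ∘ suc) n (λ i i<n → h (suc i) (s≤s i<n))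

concat-applyUpTo-[] : ∀ {A : Set} (f : ℕ → List A) n → (∀ i → i < n → f i ≡ []) → concat (applyUpTo f n) ≡ []
concat-applyUpTo-[] f zero _ = refl
concat-applyUpTo-[] f (suc n) h rewrite h 0 (s≤s z≤n) = concat-applyUpTo-[] (f ∘ suc) n (λ i i<n → h (suc i) (s≤s i<n))

concat-applyUpTo-[_] : ∀ {A : Set} (f : ℕ → A) n → concat (applyUpTo (λ i → [ f i ]) n) ≡ applyUpTo f n
concat-applyUpTo-[ f ] zero = refl
concat-applyUpTo-[ f ] (suc n) = cong (f 0 ∷_) (concat-applyUpTo-[ f ∘ suc ] n)

grid : ∀ {A : Set} → (ℕ → ℕ) → ℕ → (ℕ → ℕ → A) → List A
grid len m g = concat (applyUpTo (λ r → applyUpTo (g r) (len r)) m)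

prefixSum : (ℕ → ℕ) → ℕ → ℕ
prefixSum f zero = 0
prefixSum f (suc r) = prefixSum f r + f r

prefixSum-suc : ∀ f r → prefixSum f (suc r) ≡ f 0 + prefixSum (f ∘ suc) r
prefixSum-suc f zero = +-comm 0 (f 0)
prefixSum-suc f (suc r) = trans (cong (_+ f (suc r)) (prefixSum-suc f r)) (+-assoc (f 0) _ _)

sum-map-concat : ∀ {A : Set} (g : A → ℕ) (xss : List (List A)) → sum (map g (concat xss)) ≡ sum (map (sum ∘ map g) xss)
sum-map-concat g [] = refl
sum-map-concat g (xs ∷ xss) = begin
  sum (map g (xs ++ concat xss))             ≡⟨ cong sum (map-++ g xs (concat xss)) ⟩
  sum (map g xs ++ map g (concat xss))       ≡⟨ sum-++ (map g xs) _ ⟩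
  sum (map g xs) + sum (map g (concat xss))  ≡⟨ cong (sum (map g xs) +_) (sum-map-concat g xss) ⟩
  sum (map (sum ∘ map g) (xs ∷ xss))         ∎
  where open ≡-Reasoning

sum-map-cong : ∀ {A : Set} {f g : A → ℕ} xs → (∀ x → x ∈ xs → f x ≡ g x) → sum (map f xs) ≡ sum (map g xs)
sum-map-cong [] _ = refl
sum-map-cong (x ∷ xs) f≡g = cong₂ _+_ (f≡g x (here refl)) (sum-map-cong xs (λ y y∈xs → f≡g y (there y∈xs)))

sum-applyUpTo-cong : ∀ {f g : ℕ → ℕ} n → (∀ i → i < n → f i ≡ g i) → sum (applyUpTo f n) ≡ sum (applyUpTo g n)
sum-applyUpTo-cong n f≡g = cong sum (applyUpTo-cong n f≡g)

sum-applyUpTo-+ : ∀ (f g : ℕ → ℕ) n → sum (applyUpTo (λ i → f i + g i) n) ≡ sum (applyUpTo f n) + sum (applyUpTo g n)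
sum-applyUpTo-+ f g zero = refl
sum-applyUpTo-+ f g (suc n) rewrite sum-applyUpTo-+ (f ∘ suc) (g ∘ suc) n = interchange (f 0) (g 0) _ _
  where
  interchange : ∀ a b c d → a + b + (c + d) ≡ a + c + (b + d)
  interchange = solve-∀

sum-applyUpTo-zero : ∀ (f : ℕ → ℕ) n → (∀ i → i < n → f i ≡ 0) → sum (applyUpTo f n) ≡ 0
sum-applyUpTo-zero f zero _ = refl
sum-applyUpTo-zero f (suc n) h = cong₂ _+_ (h 0 (s≤s z≤n)) (sum-applyUpTo-zero (f ∘ suc) n (λ i i<n → h (suc i) (s≤s i<n)))

sum-applyUpTo-single : ∀ (f : ℕ → ℕ) n m → (∀ i → i < n → i ≢ m → f i ≡ 0) →
  sum (applyUpTo f n) ≡ (if m <ᵇ n then f m else 0)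
sum-applyUpTo-single f zero m _ = refl
sum-applyUpTo-single f (suc n) zero h =
  trans (cong (f 0 +_) (sum-applyUpTo-zero (f ∘ suc) n (λ i i<n → h (suc i) (s≤s i<n) λ ()))) (+-identityʳ (f 0))
sum-applyUpTo-single f (suc n) (suc m) h =
  cong₂ _+_ (h 0 (s≤s z≤n) λ ()) (sum-applyUpTo-single (f ∘ suc) n m (λ i i<n i≢m → h (suc i) (s≤s i<n) (i≢m ∘ suc-injective)))

sum-applyUpTo-indicator : ∀ (f : ℕ → ℕ) n m → m < n → sum (applyUpTo (λ i → if i ≡ᵇ m then f i else 0) n) ≡ f m
sum-applyUpTo-indicator f n m m<n = trans (sum-applyUpTo-single _ n m (λ i _ i≢m → off i i≢m))
  (trans (cong (λ b → if b then (if m ≡ᵇ m then f m else 0) else 0) (<ᵇ-true m<n)) on)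
  where
  off : ∀ i → i ≢ m → (if i ≡ᵇ m then f i else 0) ≡ 0
  off i i≢m rewrite ≡ᵇ-false i≢m = refl
  on : (if m ≡ᵇ m then f m else 0) ≡ f m
  on rewrite ≡ᵇ-true {m} refl = refl

any-map : ∀ {A B : Set} (p : B → Bool) (f : A → B) xs → any p (map f xs) ≡ any (p ∘ f) xs
any-map p f [] = refl
any-map p f (x ∷ xs) = cong (p (f x) ∨_) (any-map p f xs)

any-++ : ∀ {A : Set} (p : A → Bool) xs ys → any p (xs ++ ys) ≡ any p xs ∨ any p ys
any-++ p [] ys = refl
any-++ p (x ∷ xs) ys rewrite any-++ p xs ys with p x
... | true = refl
... | false = refl

any-false : ∀ {A : Set} (p : A → Bool) xs → All (λ x → p x ≡ false) xs → any p xs ≡ false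
any-false p [] [] = refl
any-false p (x ∷ xs) (px ∷ pxs) rewrite px = any-false p xs pxs

any-true : ∀ {A : Set} (p : A → Bool) {x} xs → x ∈ xs → p x ≡ true → any p xs ≡ true
any-true p (y ∷ xs) (here refl) px rewrite px = refl
any-true p (y ∷ xs) (there x∈xs) px with p y
... | true = refl
... | false = any-true p xs x∈xs px

any-cong : ∀ {A : Set} {p q : A → Bool} xs → (∀ x → x ∈ xs → p x ≡ q x) → any p xs ≡ any q xs
any-cong [] _ = refl
any-cong (x ∷ xs) p≡q = cong₂ _∨_ (p≡q x (here refl)) (any-cong xs (λ y y∈xs → p≡q y (there y∈xs)))

filter-does : ∀ {A : Set} {P : A → Set} (P? : ∀ x → Dec (P x)) (p : A → Bool) → (∀ x → does (P? x) ≡ p x) →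
  ∀ xs → filter P? xs ≡ filterᵇ p xs
filter-does P? p eq [] = refl
filter-does P? p eq (x ∷ xs) rewrite eq x with p x
... | true = cong (x ∷_) (filter-does P? p eq xs)
... | false = filter-does P? p eq xs

filterᵇ-accept : ∀ {A : Set} (p : A → Bool) {x} xs → p x ≡ true → filterᵇ p (x ∷ xs) ≡ x ∷ filterᵇ p xs
filterᵇ-accept p xs px rewrite px = refl

filterᵇ-reject : ∀ {A : Set} (p : A → Bool) {x} xs → p x ≡ false → filterᵇ p (x ∷ xs) ≡ filterᵇ p xs
filterᵇ-reject p xs px rewrite px = refl

filterᵇ-∷ : ∀ {A : Set} (p : A → Bool) x xs → filterᵇ p (x ∷ xs) ≡ (if p x then x ∷ filterᵇ p xs else filterᵇ p xs)
filterᵇ-∷ p x xs with p x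
... | true = refl
... | false = refl

filterᵇ-all : ∀ {A : Set} (p : A → Bool) xs → All (λ x → p x ≡ true) xs → filterᵇ p xs ≡ xs
filterᵇ-all p [] [] = refl
filterᵇ-all p (x ∷ xs) (px ∷ pxs) = trans (filterᵇ-accept p xs px) (cong (x ∷_) (filterᵇ-all p xs pxs))

filterᵇ-none : ∀ {A : Set} (p : A → Bool) xs → All (λ x → p x ≡ false) xs → filterᵇ p xs ≡ []
filterᵇ-none p [] [] = refl
filterᵇ-none p (x ∷ xs) (px ∷ pxs) = trans (filterᵇ-reject p xs px) (filterᵇ-none p xs pxs)

filterᵇ-cong : ∀ {A : Set} {p q : A → Bool} xs → (∀ x → x ∈ xs → p x ≡ q x) → filterᵇ p xs ≡ filterᵇ q xs
filterᵇ-cong [] _ = refl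
filterᵇ-cong {p = p} {q} (x ∷ xs) p≡q rewrite p≡q x (here refl) with q x
... | true = cong (x ∷_) (filterᵇ-cong xs (λ y y∈xs → p≡q y (there y∈xs)))
... | false = filterᵇ-cong xs (λ y y∈xs → p≡q y (there y∈xs))

filterᵇ-comm : ∀ {A : Set} (p q : A → Bool) xs → filterᵇ p (filterᵇ q xs) ≡ filterᵇ q (filterᵇ p xs)
filterᵇ-comm p q [] = refl
filterᵇ-comm p q (x ∷ xs) with p x in px | q x in qx
... | true | true rewrite px | qx = cong (x ∷_) (filterᵇ-comm p q xs)
... | true | false rewrite qx = filterᵇ-comm p q xs
... | false | true rewrite px = filterᵇ-comm p q xs
... | false | false = filterᵇ-comm p q xs

filterᵇ-absorb : ∀ {A : Set} (p q : A → Bool) xs → (∀ x → p x ≡ true → q x ≡ true) →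
  filterᵇ p (filterᵇ q xs) ≡ filterᵇ p xs
filterᵇ-absorb p q [] _ = refl
filterᵇ-absorb p q (x ∷ xs) p⇒q with p x in px
... | true rewrite p⇒q x px | px = cong (x ∷_) (filterᵇ-absorb p q xs p⇒q)
... | false with q x
... | true rewrite px = filterᵇ-absorb p q xs p⇒q
... | false = filterᵇ-absorb p q xs p⇒q

filterᵇ-map : ∀ {A B : Set} (p : B → Bool) (f : A → B) xs → filterᵇ p (map f xs) ≡ map f (filterᵇ (p ∘ f) xs)
filterᵇ-map p f [] = refl
filterᵇ-map p f (x ∷ xs) with p (f x)
... | true = cong (f x ∷_) (filterᵇ-map p f xs)
... | false = filterᵇ-map p f xs

filterᵇ-++ : ∀ {A : Set} (p : A → Bool) xs ys → filterᵇ p (xs ++ ys) ≡ filterᵇ p xs ++ filterᵇ p ys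
filterᵇ-++ p = filter-++ (T? ∘ p)

filterᵇ-concat : ∀ {A : Set} (p : A → Bool) xss → filterᵇ p (concat xss) ≡ concat (map (filterᵇ p) xss)
filterᵇ-concat p [] = refl
filterᵇ-concat p (xs ∷ xss) = trans (filterᵇ-++ p xs (concat xss)) (cong (filterᵇ p xs ++_) (filterᵇ-concat p xss))

∈-filterᵇ : ∀ {A : Set} (p : A → Bool) {x} xs → x ∈ xs → p x ≡ true → x ∈ filterᵇ p xs
∈-filterᵇ p (y ∷ xs) (here refl) px rewrite px = here refl
∈-filterᵇ p (y ∷ xs) (there x∈xs) px with p y
... | true = there (∈-filterᵇ p xs x∈xs px)
... | false = ∈-filterᵇ p xs x∈xs px

length-filterᵇ : ∀ {A : Set} (p : A → Bool) xs → length (filterᵇ p xs) ≤ length xs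
length-filterᵇ p [] = z≤n
length-filterᵇ p (x ∷ xs) with p x
... | true = s≤s (length-filterᵇ p xs)
... | false = m≤n⇒m≤1+n (length-filterᵇ p xs)

module Dedup {A : Set} (R : A → A → Bool) where

  deduplicateᵇ-∷ : ∀ x xs → deduplicateᵇ R (x ∷ xs) ≡ x ∷ filterᵇ (λ y → not (R x y)) (deduplicateᵇ R xs)
  deduplicateᵇ-∷ x xs = cong (x ∷_) (filter-does _ _ (λ _ → refl) (deduplicateᵇ R xs))

  keepFresh : List A → List A → List A
  keepFresh seen [] = []
  keepFresh seen (x ∷ xs) =
    if any (λ y → R y x) seen then keepFresh (x ∷ seen) xs else x ∷ keepFresh (x ∷ seen) xs

  keepFresh-cong : ∀ s s′ xs → (∀ y → any (λ z → R z y) s ≡ any (λ z → R z y) s′) → keepFresh s xs ≡ keepFresh s′ xs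
  keepFresh-cong s s′ [] _ = refl
  keepFresh-cong s s′ (x ∷ xs) s≈s′ rewrite s≈s′ x with any (λ z → R z x) s′
  ... | true = keepFresh-cong (x ∷ s) (x ∷ s′) xs (λ y → cong (R x y ∨_) (s≈s′ y))
  ... | false = cong (x ∷_) (keepFresh-cong (x ∷ s) (x ∷ s′) xs (λ y → cong (R x y ∨_) (s≈s′ y)))

  private
    any-swap : ∀ z x s y → any (λ w → R w y) (z ∷ x ∷ s) ≡ any (λ w → R w y) (x ∷ z ∷ s)
    any-swap z x s y with R z y | R x y
    ... | true | true = refl
    ... | true | false = refl
    ... | false | true = refl
    ... | false | false = refl

  filterᵇ-keepFresh : ∀ z s xs → filterᵇ (λ y → not (R z y)) (keepFresh s xs) ≡ keepFresh (z ∷ s) xs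
  filterᵇ-keepFresh z s [] = refl
  filterᵇ-keepFresh z s (x ∷ xs) with any (λ y → R y x) s
  ... | true with R z x
  ...   | true = trans (filterᵇ-keepFresh z (x ∷ s) xs) (keepFresh-cong _ _ xs (any-swap z x s))
  ...   | false = trans (filterᵇ-keepFresh z (x ∷ s) xs) (keepFresh-cong _ _ xs (any-swap z x s))
  filterᵇ-keepFresh z s (x ∷ xs) | false with R z x
  ... | true = trans (filterᵇ-keepFresh z (x ∷ s) xs) (keepFresh-cong _ _ xs (any-swap z x s))
  ... | false = cong (x ∷_) (trans (filterᵇ-keepFresh z (x ∷ s) xs) (keepFresh-cong _ _ xs (any-swap z x s)))

  deduplicateᵇ-keepFresh : ∀ xs → deduplicateᵇ R xs ≡ keepFresh [] xs
  deduplicateᵇ-keepFresh [] = refl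
  deduplicateᵇ-keepFresh (x ∷ xs) = trans (deduplicateᵇ-∷ x xs)
    (cong (x ∷_) (trans (cong (filterᵇ (λ y → not (R x y))) (deduplicateᵇ-keepFresh xs)) (filterᵇ-keepFresh x [] xs)))

  ʳ++-++ : ∀ (xs s t : List A) → xs ʳ++ (s ++ t) ≡ (xs ʳ++ s) ++ t
  ʳ++-++ [] s t = refl
  ʳ++-++ (x ∷ xs) s t = ʳ++-++ xs (x ∷ s) t

  keepFresh-++ : ∀ s xs ys → keepFresh s (xs ++ ys) ≡ keepFresh s xs ++ keepFresh (xs ʳ++ s) ys
  keepFresh-++ s [] ys = refl
  keepFresh-++ s (x ∷ xs) ys with any (λ y → R y x) s
  ... | true = keepFresh-++ (x ∷ s) xs ys
  ... | false = cong (x ∷_) (keepFresh-++ (x ∷ s) xs ys)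

  keepFresh-unrelated : ∀ s older xs → All (λ y → any (λ z → R z y) older ≡ false) xs →
    keepFresh (s ++ older) xs ≡ keepFresh s xs
  keepFresh-unrelated s older [] _ = refl
  keepFresh-unrelated s older (x ∷ xs) (x∉older ∷ h)
    rewrite any-++ (λ z → R z x) s older | x∉older | ∨-identityʳ (any (λ z → R z x) s)
    with any (λ z → R z x) s
  ... | true = keepFresh-unrelated (x ∷ s) older xs h
  ... | false = cong (x ∷_) (keepFresh-unrelated (x ∷ s) older xs h)

  keepFresh-map : ∀ (f : A → A) → (∀ a b → R (f a) (f b) ≡ R a b) →
    ∀ s xs → keepFresh (map f s) (map f xs) ≡ map f (keepFresh s xs)
  keepFresh-map f f-resp s [] = refl
  keepFresh-map f f-resp s (x ∷ xs)
    rewrite any-map (λ y → R y (f x)) f s | any-cong {p = λ y → R (f y) (f x)} {q = λ y → R y x} s (λ y _ → f-resp y x)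
    with any (λ y → R y x) s
  ... | true = keepFresh-map f f-resp (x ∷ s) xs
  ... | false = cong (f x ∷_) (keepFresh-map f f-resp (x ∷ s) xs)

  filterᵇ-deduplicateᵇ : ∀ (p : A → Bool) → (∀ a b → R a b ≡ true → p a ≡ p b) →
    ∀ xs → filterᵇ p (deduplicateᵇ R xs) ≡ deduplicateᵇ R (filterᵇ p xs)
  filterᵇ-deduplicateᵇ p p-resp [] = refl
  filterᵇ-deduplicateᵇ p p-resp (x ∷ xs) = trans (cong (filterᵇ p) (deduplicateᵇ-∷ x xs)) step
    where
    step : filterᵇ p (x ∷ filterᵇ (λ y → not (R x y)) (deduplicateᵇ R xs)) ≡ deduplicateᵇ R (filterᵇ p (x ∷ xs))
    step with p x in px
    ... | true = trans
      (cong (x ∷_) (trans (filterᵇ-comm p (λ y → not (R x y)) (deduplicateᵇ R xs))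
                          (cong (filterᵇ (λ y → not (R x y))) (filterᵇ-deduplicateᵇ p p-resp xs))))
      (sym (deduplicateᵇ-∷ x (filterᵇ p xs)))
    ... | false = trans (filterᵇ-absorb p (λ y → not (R x y)) (deduplicateᵇ R xs) unrelated)
                        (filterᵇ-deduplicateᵇ p p-resp xs)
      where
      unrelated : ∀ y → p y ≡ true → not (R x y) ≡ true
      unrelated y py with R x y in xRy
      ... | false = refl
      ... | true with trans (sym px) (trans (p-resp x y xRy) py)
      ...   | ()

  ∈-deduplicateᵇ : (∀ a b → R a b ≡ true → a ≡ b) → ∀ {x} xs → x ∈ xs → x ∈ deduplicateᵇ R xs
  ∈-deduplicateᵇ R⇒≡ (y ∷ xs) (here refl) rewrite deduplicateᵇ-∷ y xs = here refl
  ∈-deduplicateᵇ R⇒≡ {x} (y ∷ xs) (there x∈xs) rewrite deduplicateᵇ-∷ y xs with R y x in yRx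
  ... | true rewrite R⇒≡ y x yRx = here refl
  ... | false = there (∈-filterᵇ (λ z → not (R y z)) (deduplicateᵇ R xs) (∈-deduplicateᵇ R⇒≡ xs x∈xs) (cong not yRx))

  Unrelated : List A → Set
  Unrelated [] = ⊤
  Unrelated (x ∷ xs) = All (λ y → R x y ≡ false) xs × Unrelated xs

  deduplicateᵇ-unrelated : ∀ xs → Unrelated xs → deduplicateᵇ R xs ≡ xs
  deduplicateᵇ-unrelated [] _ = refl
  deduplicateᵇ-unrelated (x ∷ xs) (x≁xs , h) rewrite deduplicateᵇ-∷ x xs | deduplicateᵇ-unrelated xs h =
    cong (x ∷_) (filterᵇ-all _ xs (All.map (cong not) x≁xs))

  -- If R only relates elements of equal key and the i-th block of a list has all its keys in
  -- [2(n+i)+1, 2(n+i)+3], an element can only be a duplicate of one in the same or the previous block.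
  module Blocks (key : A → ℕ) (key-resp : ∀ a b → R a b ≡ true → key a ≡ key b) where

    InWindow : ℕ → A → Set
    InWindow n a = suc (2 * n) ≤ key a × key a ≤ 3 + 2 * n

    Windowed : ℕ → List (List A) → Set
    Windowed n [] = ⊤
    Windowed n (b ∷ bs) = All (InWindow n) b × Windowed (suc n) bs

    keepFreshBlocks : List A → List (List A) → List (List A)
    keepFreshBlocks prev [] = []
    keepFreshBlocks prev (b ∷ bs) = keepFresh prev b ∷ keepFreshBlocks (reverse b) bs

    private
      All-ʳ++ : ∀ {P : A → Set} xs {s} → All P xs → All P s → All P (xs ʳ++ s)
      All-ʳ++ [] [] ps = ps
      All-ʳ++ (x ∷ xs) (px ∷ pxs) ps = All-ʳ++ xs pxs (px ∷ ps)

      unrelated-below : ∀ older y → All (λ z → key z < key y) older → any (λ z → R z y) older ≡ false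
      unrelated-below [] y [] = refl
      unrelated-below (z ∷ older) y (z<y ∷ h) with R z y in zRy
      ... | true = ⊥-elim (<-irrefl (key-resp z y zRy) z<y)
      ... | false = unrelated-below older y h

      window-suc : ∀ n → suc (2 * suc n) ≡ 3 + 2 * n
      window-suc n = cong suc (*-suc 2 n)

    keepFresh-blocks : ∀ n prev older bs → Windowed n bs →
      All (λ z → key z ≤ suc (2 * n)) prev → All (λ z → suc (key z) ≤ 2 * n) older →
      keepFresh (prev ++ older) (concat bs) ≡ concat (keepFreshBlocks prev bs)
    keepFresh-blocks n prev older [] _ _ _ = refl
    keepFresh-blocks n prev older (b ∷ bs) (b-in , bs-in) prev-below older-below = begin
      keepFresh (prev ++ older) (b ++ concat bs)
        ≡⟨ keepFresh-++ (prev ++ older) b (concat bs) ⟩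
      keepFresh (prev ++ older) b ++ keepFresh (b ʳ++ (prev ++ older)) (concat bs)
        ≡⟨ cong₂ _++_ (keepFresh-unrelated prev older b (All.map b-unrelated b-in))
                      (cong (λ s → keepFresh s (concat bs)) (ʳ++-++ b [] (prev ++ older))) ⟩
      keepFresh prev b ++ keepFresh (reverse b ++ (prev ++ older)) (concat bs)
        ≡⟨ cong (keepFresh prev b ++_) (keepFresh-blocks (suc n) (reverse b) (prev ++ older) bs bs-in
             (reverse-below b-in) (++⁺ (All.map (λ z≤ → ≤-trans (s≤s z≤) (≤-reflexive (sym (*-suc 2 n)))) prev-below)
                                       (All.map (λ z< → ≤-trans z< (≤-trans (n≤1+n _) (≤-trans (n≤1+n _) (≤-reflexive (sym (*-suc 2 n)))))) older-below))) ⟩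
      keepFresh prev b ++ concat (keepFreshBlocks (reverse b) bs) ∎
      where
      open ≡-Reasoning
      b-unrelated : ∀ {y} → InWindow n y → any (λ z → R z y) older ≡ false
      b-unrelated {y} y-in = unrelated-below older y (All.map (λ z< → ≤-trans z< (≤-trans (n≤1+n _) (proj₁ y-in))) older-below)
      reverse-below : All (InWindow n) b → All (λ z → key z ≤ suc (2 * suc n)) (reverse b)
      reverse-below h = All-ʳ++ b (All.map (λ z-in → ≤-trans (proj₂ z-in) (≤-reflexive (sym (window-suc n)))) h) []

    deduplicateᵇ-blocks : ∀ bs → Windowed 0 bs → deduplicateᵇ R (concat bs) ≡ concat (keepFreshBlocks [] bs)
    deduplicateᵇ-blocks bs bs-in = trans (deduplicateᵇ-keepFresh (concat bs)) (keepFresh-blocks 0 [] [] bs bs-in [] [])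

    Windowed-++ : ∀ n xs ys → Windowed n xs → Windowed (n + length xs) ys → Windowed n (xs ++ ys)
    Windowed-++ n [] ys _ h = subst (λ m → Windowed m ys) (+-identityʳ n) h
    Windowed-++ n (x ∷ xs) ys (hx , h) h′ = hx , Windowed-++ (suc n) xs ys h (subst (λ m → Windowed m ys) (+-suc n (length xs)) h′)

    Windowed-applyUpTo : ∀ n (f : ℕ → List A) m → (∀ t → t < m → All (InWindow (n + t)) (f t)) → Windowed n (applyUpTo f m)
    Windowed-applyUpTo n f zero _ = tt
    Windowed-applyUpTo n f (suc m) h = subst (λ n′ → All (InWindow n′) (f 0)) (+-identityʳ n) (h 0 (s≤s z≤n)) ,
      Windowed-applyUpTo (suc n) (f ∘ suc) m (λ t t<m → subst (λ n′ → All (InWindow n′) (f (suc t))) (+-suc n t) (h (suc t) (s≤s t<m)))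

    Windowed-grid : ∀ n (len : ℕ → ℕ) m (g : ℕ → ℕ → List A) →
      (∀ r t → r < m → t < len r → All (InWindow (n + (prefixSum len r + t))) (g r t)) →
      Windowed n (grid len m g)
    Windowed-grid n len zero g h = tt
    Windowed-grid n len (suc m) g h = Windowed-++ n (applyUpTo (g 0) (len 0)) _
      (Windowed-applyUpTo n (g 0) (len 0) (λ t t<l → h 0 t (s≤s z≤n) t<l))
      (subst (λ n′ → Windowed (n + n′) (grid (len ∘ suc) m (g ∘ suc))) (sym (length-applyUpTo (g 0) (len 0)))
        (Windowed-grid (n + len 0) (len ∘ suc) m (g ∘ suc) (λ r t r<m t<l →
          subst (λ n′ → All (InWindow n′) (g (suc r) t)) (shift r t) (h (suc r) t (s≤s r<m) t<l))))
      where
      shift : ∀ r t → n + (prefixSum len (suc r) + t) ≡ n + len 0 + (prefixSum (len ∘ suc) r + t)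
      shift r t = trans (cong (λ s → n + (s + t)) (prefixSum-suc len r))
        (trans (cong (n +_) (+-assoc (len 0) _ t)) (sym (+-assoc n (len 0) _)))

    keepFreshBlocks-applyUpTo : ∀ prev (f : ℕ → List A) m rest → keepFreshBlocks prev (applyUpTo f (suc m) ++ rest) ≡
      keepFresh prev (f 0) ∷ (applyUpTo (λ t → keepFresh (reverse (f t)) (f (suc t))) m ++ keepFreshBlocks (reverse (f m)) rest)
    keepFreshBlocks-applyUpTo prev f zero rest = refl
    keepFreshBlocks-applyUpTo prev f (suc m) rest = cong (keepFresh prev (f 0) ∷_) (keepFreshBlocks-applyUpTo (reverse (f 0)) (f ∘ suc) m rest)

    previousBlock : (len : ℕ → ℕ) (g : ℕ → ℕ → List A) → List A → ℕ → List A
    previousBlock len g prev zero = prev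
    previousBlock len g prev (suc r) = reverse (g r (len r ∸ 1))

    keepFreshBlocks-grid : ∀ (len : ℕ → ℕ) m (g : ℕ → ℕ → List A) prev → (∀ r → r < m → 1 ≤ len r) →
      keepFreshBlocks prev (grid len m g) ≡
      concat (applyUpTo (λ r → keepFresh (previousBlock len g prev r) (g r 0)
                             ∷ applyUpTo (λ t → keepFresh (reverse (g r t)) (g r (suc t))) (len r ∸ 1)) m)
    keepFreshBlocks-grid len zero g prev _ = refl
    keepFreshBlocks-grid len (suc m) g prev len≥1 with len 0 in len₀ | len≥1 0 (s≤s z≤n)
    ... | suc l | _ = begin
      keepFreshBlocks prev (applyUpTo (g 0) (suc l) ++ grid (len ∘ suc) m (g ∘ suc))
        ≡⟨ keepFreshBlocks-applyUpTo prev (g 0) l _ ⟩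
      keepFresh prev (g 0 0) ∷ (applyUpTo (λ t → keepFresh (reverse (g 0 t)) (g 0 (suc t))) l
                                ++ keepFreshBlocks (reverse (g 0 l)) (grid (len ∘ suc) m (g ∘ suc)))
        ≡⟨ cong (λ rest → keepFresh prev (g 0 0) ∷ (applyUpTo (λ t → keepFresh (reverse (g 0 t)) (g 0 (suc t))) l ++ rest))
             (trans (keepFreshBlocks-grid (len ∘ suc) m (g ∘ suc) (reverse (g 0 l)) (λ r r<m → len≥1 (suc r) (s≤s r<m)))
                    (cong concat (applyUpTo-cong m (λ r _ → cong (λ p → keepFresh p (g (suc r) 0) ∷ _) (previous r))))) ⟩
      _ ∎
      where
      open ≡-Reasoning
      previous : ∀ r → previousBlock (len ∘ suc) (g ∘ suc) (reverse (g 0 l)) r ≡ previousBlock len g prev (suc r)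
      previous zero rewrite len₀ = refl
      previous (suc r) = refl

module _ {A : Set} (key : A → ℕ) where

  private
    count : (A → Bool) → List A → ℕ
    count p xs = length (filterᵇ p xs)

    count-split : ∀ m xs → count (λ a → key a <ᵇ suc m) xs ≡ count (λ a → key a <ᵇ m) xs + count (λ a → key a ≡ᵇ m) xs
    count-split m [] = refl
    count-split m (x ∷ xs) with <-cmp (key x) m
    ... | tri< x<m _ _ rewrite <ᵇ-true {key x} {suc m} (m≤n⇒m≤1+n x<m) | <ᵇ-true x<m | ≡ᵇ-false {key x} {m} (<⇒≢ x<m) =
      cong suc (count-split m xs)
    ... | tri≈ _ x≡m _ rewrite <ᵇ-true {key x} {suc m} (s≤s (≤-reflexive x≡m)) | <ᵇ-false {key x} {m} (<-irrefl x≡m) | ≡ᵇ-true x≡m =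
      trans (cong suc (count-split m xs)) (sym (+-suc _ _))
    ... | tri> _ _ m<x rewrite <ᵇ-false {key x} {suc m} (λ x<1+m → <-irrefl refl (≤-trans (s≤s x<1+m) (s≤s m<x)))
                             | <ᵇ-false {key x} {m} (λ x<m → <-asym x<m m<x) | ≡ᵇ-false {key x} {m} (λ x≡m → <-irrefl (sym x≡m) m<x) =
      count-split m xs

    count-hit : ∀ (p : A → Bool) {x} xs → x ∈ xs → p x ≡ true → 1 ≤ count p xs
    count-hit p xs x∈xs px with filterᵇ p xs | ∈-filterᵇ p xs x∈xs px
    ... | _ ∷ _ | _ = s≤s z≤n

    count-below : ∀ xs m → (∀ i → i < m → ∃[ a ] (a ∈ xs × key a ≡ i)) → m ≤ count (λ a → key a <ᵇ m) xs
    count-below xs zero _ = z≤n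
    count-below xs (suc m) hit with hit m ≤-refl
    ... | a , a∈xs , a↦m = begin
      suc m ≡⟨ +-comm 1 m ⟩
      m + 1 ≤⟨ +-mono-≤ (count-below xs m (λ i i<m → hit i (m≤n⇒m≤1+n i<m))) (count-hit (λ a → key a ≡ᵇ m) xs a∈xs (≡ᵇ-true a↦m)) ⟩
      count (λ a → key a <ᵇ m) xs + count (λ a → key a ≡ᵇ m) xs ≡⟨ count-split m xs ⟨
      count (λ a → key a <ᵇ suc m) xs ∎
      where open ≤-Reasoning

  length-≥-keys : ∀ xs m → (∀ i → i < m → ∃[ a ] (a ∈ xs × key a ≡ i)) → m ≤ length xs
  length-≥-keys xs m hit = ≤-trans (count-below xs m hit) (length-filterᵇ _ xs)

-- Counting paths in an embedded graded digraph.  countPaths refuses to revisit a vertex; along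
-- arcs the height strictly increases, so that test never fires and countPaths follows the
-- plain recursion `paths`, which any solution of the path-count recursion then computes.

module PathCount {V : Set} (_==_ : V → V → Bool)
  (==-sound : ∀ a b → (a == b) ≡ true → a ≡ b) (==-refl : ∀ a → (a == a) ≡ true)
  (embed : V → Point) (Valid : V → Set) (embed-injective : ∀ a b → Valid a → Valid b → embed a ≡ embed b → a ≡ b)
  (height : V → ℕ) (arcs : List (V × V))
  (arcs-ok : All (λ e → Valid (proj₁ e) × Valid (proj₂ e) × height (proj₁ e) < height (proj₂ e)) arcs) where

  embeddedArcs : List (Point × Point)
  embeddedArcs = map (λ e → (embed (proj₁ e) , embed (proj₂ e))) arcs

  outSum : (V → ℕ) → V → ℕ
  outSum F a = sum (map (λ e → if proj₁ e == a then F (proj₂ e) else 0) arcs)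

  ==-false : ∀ a b → a ≢ b → (a == b) ≡ false
  ==-false a b a≢b with a == b in eq
  ... | false = refl
  ... | true = ⊥-elim (a≢b (==-sound a b eq))

  embed-== : ∀ a b → Valid a → Valid b → (embed a ==ᵖ embed b) ≡ (a == b)
  embed-== a b va vb with a == b in eq
  ... | true rewrite ==-sound a b eq = ==ᵖ-refl (embed b)
  ... | false = ==ᵖ-false (embed a) (embed b) (λ e → true≢false (trans (sym (==-refl a)) (trans (cong (a ==_) (embed-injective a b va vb e)) eq)))
    where
    true≢false : true ≢ false
    true≢false ()

  Below : V → List Point → Set
  Below a visited = All (λ w → ∃[ b ] (Valid b × w ≡ embed b × height b < height a)) visited

  private
    unvisited : ∀ a b visited → Valid a → Valid b → height a < height b → Below a visited →
      not (embed b ∈ᵇ (embed a ∷ visited)) ≡ true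
    unvisited a b visited va vb a<b below = cong not (any-false _ (embed a ∷ visited) (fresh va a<b ∷ All.map older below))
      where
      fresh : ∀ {c} → Valid c → height c < height b → (embed c ==ᵖ embed b) ≡ false
      fresh {c} vc c<b = trans (embed-== c b vc vb) (==-false c b (λ c≡b → <-irrefl (cong height c≡b) c<b))
      older : ∀ {w} → ∃[ c ] (Valid c × w ≡ embed c × height c < height a) → (w ==ᵖ embed b) ≡ false
      older (c , vc , refl , c<a) = fresh vc (<-trans c<a a<b)

  module _ (target : V) where

    paths : ℕ → V → ℕ
    paths fuel a with a == target
    ... | true = 1
    paths zero a | false = 0
    paths (suc fuel) a | false = outSum (paths fuel) a

    countPaths-embed : ∀ fuel a visited → Valid a → Valid target → Below a visited →
      countPaths embeddedArcs fuel visited (embed a) (embed target) ≡ paths fuel a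
    countPaths-embed fuel a visited va vt below with a == target in a≟t | embed-== a target va vt
    ... | true | e rewrite e = refl
    countPaths-embed zero a visited va vt below | false | e rewrite e = refl
    countPaths-embed (suc fuel) a visited va vt below | false | e rewrite e =
      trans (cong sum (sym (map-∘ arcs))) (sum-map-cong arcs step)
      where
      step : ∀ e → e ∈ arcs →
        (if (embed (proj₁ e) ==ᵖ embed a) ∧ not (embed (proj₂ e) ∈ᵇ (embed a ∷ visited))
         then countPaths embeddedArcs fuel (embed a ∷ visited) (embed (proj₂ e)) (embed target) else 0)
        ≡ (if proj₁ e == a then paths fuel (proj₂ e) else 0)
      step (b , c) e∈arcs with All.lookup arcs-ok e∈arcs
      ... | vb , vc , b<c rewrite embed-== b a vb va with b == a in b≟a
      ... | false = refl
      ... | true rewrite ==-sound b a b≟a | unvisited a c visited va vc b<c below =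
        countPaths-embed fuel c (embed a ∷ visited) vc vt ((a , va , refl , b<c) ∷ All.map raise below)
        where
        raise : ∀ {w} → ∃[ d ] (Valid d × w ≡ embed d × height d < height a) → ∃[ d ] (Valid d × w ≡ embed d × height d < height c)
        raise (d , vd , w≡d , d<a) = d , vd , w≡d , <-trans d<a b<c

    module _ (Φ : V → ℕ) (Φ-target : Φ target ≡ 1)
      (Φ-out : ∀ a → Valid a → (a == target) ≡ false → outSum Φ a ≡ Φ a)
      (top : ℕ) (sources-below : All (λ e → height (proj₁ e) < top) arcs) where

      paths-solution : ∀ fuel a → Valid a → top ∸ height a ≤ fuel → paths fuel a ≡ Φ a
      paths-solution fuel a va enough with a == target in a≟t
      ... | true rewrite ==-sound a target a≟t = sym Φ-target
      paths-solution zero a va enough | false = sym (trans (sym (Φ-out a va a≟t)) (trans (sum-map-cong arcs none) (sum-zeros arcs)))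
        where
        none : ∀ e → e ∈ arcs → (if proj₁ e == a then Φ (proj₂ e) else 0) ≡ 0
        none e e∈arcs with proj₁ e == a in e≟a
        ... | false = refl
        ... | true = ⊥-elim (<-irrefl refl (≤-trans (All.lookup sources-below e∈arcs)
                       (≤-trans (m∸n≡0⇒m≤n (n≤0⇒n≡0 enough)) (≤-reflexive (cong height (sym (==-sound _ _ e≟a)))))))
        sum-zeros : ∀ (es : List (V × V)) → sum (map (λ _ → 0) es) ≡ 0
        sum-zeros [] = refl
        sum-zeros (_ ∷ es) = sum-zeros es
      paths-solution (suc fuel) a va enough | false = trans (sum-map-cong arcs step) (Φ-out a va a≟t)
        where
        step : ∀ e → e ∈ arcs → (if proj₁ e == a then paths fuel (proj₂ e) else 0) ≡ (if proj₁ e == a then Φ (proj₂ e) else 0)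
        step (b , c) e∈arcs with b == a in b≟a
        ... | false = refl
        ... | true with All.lookup arcs-ok e∈arcs
        ... | _ , vc , b<c rewrite ==-sound b a b≟a =
          paths-solution fuel c vc (≤-trans (∸-monoʳ-≤ top b<c) (∸-suc-≤ top (height a) enough))
          where
          ∸-suc-≤ : ∀ m n {f} → m ∸ n ≤ suc f → m ∸ suc n ≤ f
          ∸-suc-≤ zero n _ = z≤n
          ∸-suc-≤ (suc m) zero (s≤s h) = h
          ∸-suc-≤ (suc m) (suc n) h = ∸-suc-≤ m n h

-- The fan on vertices 0, …, L + 1 has the arcs i → i + 1 (i ≤ L) and i → i + 2 (i < L);
-- fanOut L i G sums G over the heads of the arcs leaving i.

fanOut : ℕ → ℕ → (ℕ → ℕ) → ℕ
fanOut L i G = if i <ᵇ L then G (suc i) + G (suc (suc i)) else (if i ≡ᵇ L then G (suc L) else 0)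

fanOut-last : ∀ L G → fanOut L L G ≡ G (suc L)
fanOut-last L G rewrite <ᵇ-false {L} {L} (<-irrefl refl) | ≡ᵇ-true {L} refl = refl

fanOut-beyond : ∀ L G → fanOut L (suc L) G ≡ 0
fanOut-beyond L G rewrite <ᵇ-false {suc L} {L} (λ 1+L<L → <-irrefl refl (≤-trans (n≤1+n _) 1+L<L))
                        | ≡ᵇ-false {suc L} {L} (1+n≢n) = refl

fanOut-zero : ∀ L i (G : ℕ → ℕ) → (∀ m → suc i ≤ m → G m ≡ 0) → fanOut L i G ≡ 0
fanOut-zero L i G G≡0 with i <ᵇ L
... | true rewrite G≡0 (suc i) ≤-refl | G≡0 (suc (suc i)) (n≤1+n _) = refl
... | false with i ≡ᵇ L in i≟L
...   | true = trans (cong (G ∘ suc) (sym (≡ᵇ-sound i≟L))) (G≡0 (suc i) ≤-refl)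
...   | false = refl

module Fan {V : Set} (w : ℕ → V) where

  firstTriangle : List (V × V)
  firstTriangle = (w 0 , w 2) ∷ (w 0 , w 1) ∷ (w 1 , w 2) ∷ []

  nextTriangle : ℕ → List (V × V)
  nextTriangle t = (w t , w (suc (suc t))) ∷ (w (suc t) , w (suc (suc t))) ∷ []

  fanArcs : ℕ → List (List (V × V))
  fanArcs L = firstTriangle ∷ applyUpTo (λ t → nextTriangle (suc t)) (L ∸ 1)

  private
    δ : ℕ → ℕ → (ℕ → ℕ) → ℕ → ℕ
    δ j i G j′ = if j ≡ᵇ i then G j′ else 0

    δ-≢ : ∀ j i G j′ → j ≢ i → δ j i G j′ ≡ 0
    δ-≢ j i G j′ j≢i rewrite ≡ᵇ-false j≢i = refl

  sum-fanArcs : ∀ L i (G : ℕ → ℕ) (g : V × V → ℕ) → 2 ≤ L → i ≤ suc L →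
    (∀ j j′ → j ≤ L → g (w j , w j′) ≡ δ j i G j′) → sum (map (sum ∘ map g) (fanArcs L)) ≡ fanOut L i G
  sum-fanArcs (suc (suc L)) i G g (s≤s (s≤s _)) i≤ g≡δ = begin
    sum (map g firstTriangle) + sum (map (sum ∘ map g) (applyUpTo (λ t → nextTriangle (suc t)) (suc L)))
      ≡⟨ cong₂ _+_ first (trans (cong sum (map-applyUpTo (λ t → nextTriangle (suc t)) (sum ∘ map g) (suc L)))
                                (sum-applyUpTo-cong (suc L) next)) ⟩
    head i + sum (applyUpTo (λ t → short i t + long i t) (suc L))
      ≡⟨ cong (head i +_) (sum-applyUpTo-+ (short i) (long i) (suc L)) ⟩
    head i + (sum (applyUpTo (short i) (suc L)) + sum (applyUpTo (long i) (suc L)))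
      ≡⟨ collect i i≤ ⟩
    fanOut (suc (suc L)) i G ∎
    where
    open ≡-Reasoning
    head : ℕ → ℕ
    head i = δ 0 i G 2 + (δ 0 i G 1 + (δ 1 i G 2 + 0))
    short long : ℕ → ℕ → ℕ
    short i t = δ (suc t) i G (3 + t)
    long i t = δ (suc (suc t)) i G (3 + t)
    first : sum (map g firstTriangle) ≡ head i
    first = cong₂ _+_ (g≡δ 0 2 z≤n) (cong₂ _+_ (g≡δ 0 1 z≤n) (cong (_+ 0) (g≡δ 1 2 (s≤s z≤n))))
    next : ∀ t → t < suc L → sum (map g (nextTriangle (suc t))) ≡ short i t + long i t
    next t t< = cong₂ _+_ (g≡δ (suc t) _ (≤-trans (n≤1+n _) (s≤s t<)))
                          (trans (cong (_+ 0) (g≡δ (suc (suc t)) _ (s≤s t<))) (+-identityʳ _))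
    collect : ∀ i → i ≤ suc (suc (suc L)) →
      head i + (sum (applyUpTo (short i) (suc L)) + sum (applyUpTo (long i) (suc L))) ≡ fanOut (suc (suc L)) i G
    collect zero _ rewrite sum-applyUpTo-zero (short 0) (suc L) (λ _ _ → refl) = arith (G 2) (G 1)
      where
      arith : ∀ a b → a + (b + 0) + (0 + 0) ≡ b + a
      arith = solve-∀
    collect (suc zero) _
      rewrite sum-applyUpTo-single (short 1) (suc L) 0 (λ { zero _ t≢0 → ⊥-elim (t≢0 refl) ; (suc t) _ _ → refl })
            | sum-applyUpTo-zero (long 1) (suc L) (λ _ _ → refl) = arith (G 2) (G 3)
      where
      arith : ∀ a b → 0 + (0 + (a + 0)) + (b + 0) ≡ a + b
      arith = solve-∀
    collect (suc (suc i)) i≤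
      rewrite sum-applyUpTo-single (short (2 + i)) (suc L) (suc i) (λ t _ t≢ → δ-≢ (suc t) (2 + i) G _ (t≢ ∘ suc-injective))
            | sum-applyUpTo-single (long (2 + i)) (suc L) i (λ t _ t≢ → δ-≢ (2 + t) (2 + i) G _ (t≢ ∘ suc-injective ∘ suc-injective))
            | ≡ᵇ-true {i} refl
      with <-cmp i L
    ... | tri< i<L _ _ rewrite <ᵇ-true {suc i} {suc L} (s≤s i<L) | <ᵇ-true {i} {suc L} (≤-trans i<L (n≤1+n _)) =
      +-comm (G (4 + i)) (G (3 + i))
    ... | tri≈ _ refl _ rewrite <ᵇ-false {suc i} {suc i} (<-irrefl refl) | <ᵇ-true {i} {suc i} ≤-refl | ≡ᵇ-true {i} refl = refl
    ... | tri> _ _ L<i with ≤-antisym (≤-pred (≤-pred i≤)) L<i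
    ...   | refl rewrite <ᵇ-false {2 + L} {suc L} (λ 2+L<1+L → <-irrefl refl (≤-trans (n≤1+n _) 2+L<1+L))
                       | <ᵇ-false {suc L} {suc L} (<-irrefl refl) | ≡ᵇ-false {suc L} {L} 1+n≢n = refl

fanArcs-map : ∀ {V W : Set} (f : V → W) (w : ℕ → V) L →
  map (map (λ e → (f (proj₁ e) , f (proj₂ e)))) (Fan.fanArcs w L) ≡ Fan.fanArcs (f ∘ w) L
fanArcs-map f w L = cong (_ ∷_) (map-applyUpTo (λ t → Fan.nextTriangle w (suc t)) _ (L ∸ 1))

fanArcs-cong : ∀ {V : Set} {w w′ : ℕ → V} L → (∀ i → i ≤ suc (suc L) → w i ≡ w′ i) → Fan.fanArcs w (suc L) ≡ Fan.fanArcs w′ (suc L)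
fanArcs-cong {w = w} {w′} L w≡w′ = cong₂ _∷_
  (cong₂ _∷_ (arc z≤n (s≤s (s≤s z≤n))) (cong₂ _∷_ (arc z≤n (s≤s z≤n)) (cong₂ _∷_ (arc (s≤s z≤n) (s≤s (s≤s z≤n))) refl)))
  (applyUpTo-cong L (λ t t<L → cong₂ _∷_ (arc (≤-trans t<L (≤-trans (n≤1+n L) (n≤1+n _))) (s≤s (s≤s t<L)))
                                          (cong₂ _∷_ (arc (s≤s (s≤s (<⇒≤ t<L))) (s≤s (s≤s t<L))) refl)))
  where
  arc : ∀ {i j} → i ≤ suc (suc L) → j ≤ suc (suc L) → (w i , w j) ≡ (w′ i , w′ j)
  arc {i} {j} i≤ j≤ = cong₂ _,_ (w≡w′ i i≤) (w≡w′ j j≤)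

All-fanArcs : ∀ {V : Set} {P : V × V → Set} (w : ℕ → V) L →
  (∀ j j′ → j < j′ → j′ ≤ suc (suc L) → j ≤ suc L → P (w j , w j′)) → All P (concat (Fan.fanArcs w (suc L)))
All-fanArcs w L P-arc = ++⁺
  (P-arc 0 2 (s≤s z≤n) (s≤s (s≤s z≤n)) z≤n ∷ P-arc 0 1 (s≤s z≤n) (s≤s z≤n) z≤n ∷ P-arc 1 2 ≤-refl (s≤s (s≤s z≤n)) (s≤s z≤n) ∷ [])
  (concat⁺ (All-applyUpTo _ L (λ t t<L →
     P-arc (suc t) (3 + t) (s≤s (n≤1+n _)) (s≤s (s≤s t<L)) (s≤s (≤-trans (n≤1+n _) t<L))
     ∷ P-arc (2 + t) (3 + t) ≤-refl (s≤s (s≤s t<L)) (s≤s t<L) ∷ [])))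

∈-fanArcs : ∀ {V : Set} (w : ℕ → V) L m → m ≤ suc L → (w m , w (suc m)) ∈ concat (Fan.fanArcs w (suc L))
∈-fanArcs w L zero _ = there (here refl)
∈-fanArcs w L (suc zero) _ = there (there (here refl))
∈-fanArcs w L (suc (suc t)) (s≤s t<L) =
  ∈-++⁺ʳ (Fan.firstTriangle w) (∈-concat⁺′ (there (here refl)) (∈-applyUpTo⁺ (λ t → Fan.nextTriangle w (suc t)) t<L))

lookup₀ : List ℕ → ℕ → ℕ
lookup₀ [] n = 0
lookup₀ (x ∷ xs) zero = x
lookup₀ (x ∷ xs) (suc n) = lookup₀ xs n

columnStart : List ℕ → ℕ → ℕ
columnStart Ls = prefixSum (λ r → lookup₀ Ls r ∸ 1)

hourglassTiles : List ℕ → List Point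
hourglassTiles Ls = grid (lookup₀ Ls) (length Ls) (λ r t → (columnStart Ls r + t , r))

private
  scanl-rights : ∀ x y a S → scanl move (x , y) (replicate a right ++ S) ≡
    applyUpTo (λ t → (x + t , y)) a ++ scanl move (x + a , y) S
  scanl-rights x y zero S rewrite +-identityʳ x = refl
  scanl-rights x y (suc a) S = cong₂ _∷_ (cong (_, y) (sym (+-identityʳ x)))
    (trans (scanl-rights (suc x) y a S)
       (cong₂ _++_ (applyUpTo-cong a (λ i _ → cong (_, y) (sym (+-suc x i)))) (cong (λ x′ → scanl move (x′ , y) S) (sym (+-suc x a)))))

  row-from : ∀ x y a → applyUpTo (λ t → (x + t , y)) a ++ [ (x + a , y) ] ≡ applyUpTo (λ t → (x + (0 + t) , y + 0)) (suc a)
  row-from x y a = trans (applyUpTo-∷ʳ (λ t → (x + t , y)) a)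
    (applyUpTo-cong (suc a) (λ t _ → cong₂ _,_ (refl {x = x + t}) (sym (+-identityʳ y))))

  scanl-hourglass : ∀ x y L M → 1 ≤ L → All (1 ≤_) M →
    scanl move (x , y) (chainSteps right (intersperse 2 (L ∷ M))) ≡
    grid (lookup₀ (L ∷ M)) (suc (length M)) (λ r t → (x + (columnStart (L ∷ M) r + t) , y + r))
  scanl-hourglass x y (suc a) [] (s≤s z≤n) [] = begin
    scanl move (x , y) (replicate a right ++ [])
      ≡⟨ scanl-rights x y a [] ⟩
    applyUpTo (λ t → (x + t , y)) a ++ [ (x + a , y) ]
      ≡⟨ row-from x y a ⟩
    applyUpTo (λ t → (x + (0 + t) , y + 0)) (suc a)
      ≡⟨ ++-identityʳ (applyUpTo (λ t → (x + (0 + t) , y + 0)) (suc a)) ⟨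
    grid (lookup₀ (suc a ∷ [])) 1 (λ r t → (x + (columnStart (suc a ∷ []) r + t) , y + r)) ∎
    where open ≡-Reasoning
  scanl-hourglass x y (suc a) (L′ ∷ M) (s≤s z≤n) (1≤L′ ∷ 1≤M) = begin
    scanl move (x , y) (replicate a right ++ (up ∷ chainSteps right (intersperse 2 (L′ ∷ M))))
      ≡⟨ scanl-rights x y a _ ⟩
    applyUpTo (λ t → (x + t , y)) a ++ ((x + a , y) ∷ scanl move (x + a , suc y) (chainSteps right (intersperse 2 (L′ ∷ M))))
      ≡⟨ ++-assoc (applyUpTo (λ t → (x + t , y)) a) [ (x + a , y) ] _ ⟨
    (applyUpTo (λ t → (x + t , y)) a ++ [ (x + a , y) ]) ++ scanl move (x + a , suc y) (chainSteps right (intersperse 2 (L′ ∷ M)))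
      ≡⟨ cong₂ _++_ (row-from x y a) (scanl-hourglass (x + a) (suc y) L′ M 1≤L′ 1≤M) ⟩
    applyUpTo (λ t → (x + (0 + t) , y + 0)) (suc a) ++
      grid (lookup₀ (L′ ∷ M)) (suc (length M)) (λ r t → (x + a + (columnStart (L′ ∷ M) r + t) , suc y + r))
      ≡⟨ cong (applyUpTo (λ t → (x + (0 + t) , y + 0)) (suc a) ++_) (cong concat (applyUpTo-cong (suc (length M)) (λ r _ → applyUpTo-cong (lookup₀ (L′ ∷ M) r) (λ t _ →
           cong₂ _,_ (shift r t) (sym (+-suc y r)))))) ⟩
    grid (lookup₀ (suc a ∷ L′ ∷ M)) (suc (length (L′ ∷ M))) (λ r t → (x + (columnStart (suc a ∷ L′ ∷ M) r + t) , y + r)) ∎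
    where
    open ≡-Reasoning
    shift : ∀ r t → x + a + (columnStart (L′ ∷ M) r + t) ≡ x + (columnStart (suc a ∷ L′ ∷ M) (suc r) + t)
    shift r t = trans (+-assoc x a _) (cong (x +_) (trans (sym (+-assoc a _ t))
      (cong (_+ t) (sym (prefixSum-suc (λ r → lookup₀ (suc a ∷ L′ ∷ M) r ∸ 1) r)))))

snakeTiles-hourglass : ∀ Ls → 1 ≤ length Ls → All (1 ≤_) Ls → snakeTiles (intersperse 2 Ls) ≡ hourglassTiles Ls
snakeTiles-hourglass (L ∷ M) _ (1≤L ∷ 1≤M) = scanl-hourglass 0 0 L M 1≤L 1≤M

‼-++ : ∀ {A : Set} (xs ys : List A) n → (xs ++ ys) ‼ (length xs + n) ≡ ys ‼ n
‼-++ [] ys n = refl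
‼-++ (x ∷ xs) ys n = ‼-++ xs ys n

-- the step from the last tile of row r to the first tile of row r + 1 goes up
steps-hourglass-up : ∀ Ls → All (1 ≤_) Ls → ∀ r → suc r < length Ls →
  snakeSteps (intersperse 2 Ls) ‼ (prefixSum (lookup₀ Ls) r + (lookup₀ Ls r ∸ 1)) ≡ just up
steps-hourglass-up (suc a ∷ L′ ∷ M) (s≤s z≤n ∷ _) zero _ =
  trans (cong ((replicate a right ++ (up ∷ chainSteps right (intersperse 2 (L′ ∷ M)))) ‼_)
              (trans (sym (+-identityʳ a)) (cong (_+ 0) (sym (length-replicate a)))))
        (‼-++ (replicate a right) _ 0)
steps-hourglass-up (suc a ∷ L′ ∷ L″ ∷ M) (s≤s z≤n ∷ 1≤) (suc r) (s≤s r<) =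
  trans (cong ((replicate a right ++ (up ∷ chainSteps right (intersperse 2 (L′ ∷ L″ ∷ M)))) ‼_) index)
    (trans (‼-++ (replicate a right) (up ∷ _) (suc n)) (steps-hourglass-up (L′ ∷ L″ ∷ M) 1≤ r r<))
  where
  n : ℕ
  n = prefixSum (lookup₀ (L′ ∷ L″ ∷ M)) r + (lookup₀ (L′ ∷ L″ ∷ M) r ∸ 1)
  index : prefixSum (lookup₀ (suc a ∷ L′ ∷ L″ ∷ M)) (suc r) + (lookup₀ (L′ ∷ L″ ∷ M) r ∸ 1) ≡ length (replicate a right) + suc n
  index = trans (cong (_+ (lookup₀ (L′ ∷ L″ ∷ M) r ∸ 1)) (prefixSum-suc (lookup₀ (suc a ∷ L′ ∷ L″ ∷ M)) r))
            (trans (+-assoc (suc a) _ _) (trans (sym (+-suc a n)) (cong (_+ suc n) (sym (length-replicate a)))))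
steps-hourglass-up (_ ∷ []) _ _ (s≤s ())
steps-hourglass-up (zero ∷ _) (() ∷ _) _ _
steps-hourglass-up (_ ∷ _ ∷ []) _ (suc r) (s≤s (s≤s ()))

indexFrom-++ : ∀ {A : Set} n (xs ys : List A) → indexFrom n (xs ++ ys) ≡ indexFrom n xs ++ indexFrom (n + length xs) ys
indexFrom-++ n [] ys = cong (λ m → indexFrom m ys) (sym (+-identityʳ n))
indexFrom-++ n (x ∷ xs) ys = cong ((n , x) ∷_)
  (trans (indexFrom-++ (suc n) xs ys) (cong (λ m → indexFrom (suc n) xs ++ indexFrom m ys) (sym (+-suc n (length xs)))))

indexFrom-applyUpTo : ∀ {A : Set} n (f : ℕ → A) m → indexFrom n (applyUpTo f m) ≡ applyUpTo (λ t → (n + t , f t)) m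
indexFrom-applyUpTo n f zero = refl
indexFrom-applyUpTo n f (suc m) = cong₂ _∷_ (cong (_, f 0) (sym (+-identityʳ n)))
  (trans (indexFrom-applyUpTo (suc n) (f ∘ suc) m) (applyUpTo-cong m (λ i _ → cong (_, f (suc i)) (sym (+-suc n i)))))

indexFrom-grid : ∀ {A : Set} n (len : ℕ → ℕ) m (g : ℕ → ℕ → A) →
  indexFrom n (grid len m g) ≡ grid len m (λ r t → (n + (prefixSum len r + t) , g r t))
indexFrom-grid n len zero g = refl
indexFrom-grid n len (suc m) g = begin
  indexFrom n (applyUpTo (g 0) (len 0) ++ grid (len ∘ suc) m (g ∘ suc))
    ≡⟨ indexFrom-++ n (applyUpTo (g 0) (len 0)) _ ⟩
  indexFrom n (applyUpTo (g 0) (len 0)) ++ indexFrom (n + length (applyUpTo (g 0) (len 0))) (grid (len ∘ suc) m (g ∘ suc))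
    ≡⟨ cong₂ _++_ (indexFrom-applyUpTo n (g 0) (len 0))
         (trans (cong (λ l → indexFrom (n + l) (grid (len ∘ suc) m (g ∘ suc))) (length-applyUpTo (g 0) (len 0)))
                (indexFrom-grid (n + len 0) (len ∘ suc) m (g ∘ suc))) ⟩
  applyUpTo (λ t → (n + t , g 0 t)) (len 0) ++ grid (len ∘ suc) m (λ r t → (n + len 0 + (prefixSum (len ∘ suc) r + t) , g (suc r) t))
    ≡⟨ cong (applyUpTo (λ t → (n + t , g 0 t)) (len 0) ++_) (cong concat (applyUpTo-cong m (λ r _ → applyUpTo-cong (len (suc r)) (λ t _ →
         cong (_, g (suc r) t) (trans (+-assoc n (len 0) _)
           (cong (n +_) (trans (sym (+-assoc (len 0) _ t)) (cong (_+ t) (sym (prefixSum-suc len r)))))))))) ⟩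
  grid len (suc m) (λ r t → (n + (prefixSum len r + t) , g r t)) ∎
  where open ≡-Reasoning

cNorth-suc : ∀ c i → cNorth c (suc i) ≡ not (cNorth c i)
cNorth-suc standard i = refl
cNorth-suc opposite i = refl

cNorth-parity : ∀ c m → isOdd (m + (if cNorth c (suc m) then 1 else 0)) ≡ cNorth c 1
cNorth-parity standard m with isOdd m in odd
... | true = trans (cong isOdd (+-identityʳ m)) odd
... | false = trans (cong isOdd (+-comm m 1)) (cong not odd)
cNorth-parity opposite m with isOdd m in odd
... | true = trans (cong isOdd (+-comm m 1)) (cong not odd)
... | false = trans (cong isOdd (+-identityʳ m)) odd

Edge : Set
Edge = Point × Point

-- north = true: the north edge of the tile with south-west corner (x , y) is contracted
triangle : Bool → Point → List Edge
triangle north (x , y) =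
  if north then ((sw , se) ∷ (sw , nw) ∷ (ne , se) ∷ []) else ((nw , ne) ∷ (nw , sw) ∷ (se , ne) ∷ [])
  where
  sw se nw ne : Point
  sw = (x , y)
  se = (suc x , y)
  nw = (x , suc y)
  ne = (suc x , suc y)

triangleNoWest : Bool → Point → List Edge
triangleNoWest north (x , y) =
  if north then ((sw , se) ∷ (ne , se) ∷ []) else ((nw , ne) ∷ (se , ne) ∷ [])
  where
  sw se nw ne : Point
  sw = (x , y)
  se = (suc x , y)
  nw = (x , suc y)
  ne = (suc x , suc y)

translate : Point → Point → Point
translate (dx , dy) (a , b) = (a + dx , b + dy)

translateEdge : Point → Edge → Edge
translateEdge d (p , q) = (translate d p , translate d q)

triangle-translate : ∀ north x y → triangle north (x , y) ≡ map (translateEdge (x , y)) (triangle north (0 , 0))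
triangle-translate true x y = refl
triangle-translate false x y = refl

triangle-translate-east : ∀ north x y → triangle north (suc x , y) ≡ map (translateEdge (x , y)) (triangle north (1 , 0))
triangle-translate-east true x y = refl
triangle-translate-east false x y = refl

triangle-translate-north : ∀ north x y → triangle north (x , suc y) ≡ map (translateEdge (x , y)) (triangle north (0 , 1))
triangle-translate-north true x y = refl
triangle-translate-north false x y = refl

triangleNoWest-translate-east : ∀ north x y →
  triangleNoWest north (suc x , y) ≡ map (translateEdge (x , y)) (triangleNoWest north (1 , 0))
triangleNoWest-translate-east true x y = refl
triangleNoWest-translate-east false x y = refl

==ᵖ-translate : ∀ d p q → (translate d p ==ᵖ translate d q) ≡ (p ==ᵖ q)
==ᵖ-translate (dx , dy) (a , b) (c , e) = cong₂ _∧_ (≡ᵇ-+ a c dx) (≡ᵇ-+ b e dy)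
  where
  ≡ᵇ-+ : ∀ a c d → ((a + d) ≡ᵇ (c + d)) ≡ (a ≡ᵇ c)
  ≡ᵇ-+ a c d with a ≟ c
  ... | yes refl = trans (≡ᵇ-true {a + d} refl) (sym (≡ᵇ-true {a} refl))
  ... | no a≢c = trans (≡ᵇ-false (a≢c ∘ +-cancelʳ-≡ d a c)) (sym (≡ᵇ-false a≢c))

sameGeomEdge-translate : ∀ d e e′ → sameGeomEdge (translateEdge d e) (translateEdge d e′) ≡ sameGeomEdge e e′
sameGeomEdge-translate d (p , q) (p′ , q′)
  rewrite ==ᵖ-translate d p p′ | ==ᵖ-translate d q q′ | ==ᵖ-translate d p q′ | ==ᵖ-translate d q p′ = refl

edgeWeight : Edge → ℕ
edgeWeight ((a , b) , (c , d)) = a + b + c + d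

edgeWeight-resp : ∀ e e′ → sameGeomEdge e e′ ≡ true → edgeWeight e ≡ edgeWeight e′
edgeWeight-resp (p , q) (p′ , q′) same with (p ==ᵖ p′) ∧ (q ==ᵖ q′) in direct | (p ==ᵖ q′) ∧ (q ==ᵖ p′) in swapped
... | true | _ with p ==ᵖ p′ in pp′ | q ==ᵖ q′ in qq′
...   | true | true rewrite ==ᵖ-sound p p′ pp′ | ==ᵖ-sound q q′ qq′ = refl
edgeWeight-resp ((a , b) , (c , d)) (p′ , q′) same | false | true with (a , b) ==ᵖ q′ in pq′ | (c , d) ==ᵖ p′ in qp′
...   | true | true rewrite sym (==ᵖ-sound (a , b) q′ pq′) | sym (==ᵖ-sound (c , d) p′ qp′) = swap a b c d
  where
  swap : ∀ a b c d → a + b + c + d ≡ c + d + a + b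
  swap = solve-∀

edgeWeight-translate : ∀ x y e → edgeWeight (translateEdge (x , y) e) ≡ edgeWeight e + 2 * (x + y)
edgeWeight-translate x y ((a , b) , (c , d)) = shift a b c d x y
  where
  shift : ∀ a b c d x y → a + x + (b + y) + (c + x) + (d + y) ≡ a + b + c + d + 2 * (x + y)
  shift = solve-∀

IncreasingY : (ℕ → Point) → ℕ → Set
IncreasingY f n = ∀ i → suc i < n → proj₂ (f i) < proj₂ (f (suc i))

private
  increasingY-from-0 : ∀ (f : ℕ → Point) n → IncreasingY f n → ∀ j → suc j < n → proj₂ (f 0) < proj₂ (f (suc j))
  increasingY-from-0 f n inc zero 1<n = inc 0 1<n
  increasingY-from-0 f n inc (suc j) 2+j<n = <-trans (increasingY-from-0 f n inc j (≤-trans (n≤1+n _) 2+j<n)) (inc (suc j) 2+j<n)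

sortY-increasingY : ∀ (f : ℕ → Point) n → IncreasingY f n → sortY (applyUpTo f n) ≡ applyUpTo f n
sortY-increasingY f zero _ = refl
sortY-increasingY f (suc zero) _ = refl
sortY-increasingY f (suc (suc n)) inc
  rewrite sortY-increasingY (f ∘ suc) (suc n) (λ i 2+i<2+n → inc (suc i) (s≤s 2+i<2+n))
        | ≤ᵇ-false {proj₂ (f 1)} {proj₂ (f 0)} (λ y₁≤y₀ → <-irrefl refl (≤-trans (inc 0 (s≤s (s≤s z≤n))) y₁≤y₀)) = refl

unrelated-increasingY : ∀ (f : ℕ → Point) n → IncreasingY f n → Dedup.Unrelated _==ᵖ_ (applyUpTo f n)
unrelated-increasingY f zero _ = tt
unrelated-increasingY f (suc n) inc =
  All-applyUpTo (f ∘ suc) n (λ j j<n → ==ᵖ-false (f 0) (f (suc j)) (λ same → <-irrefl (cong proj₂ same) (increasingY-from-0 f (suc n) inc j (s≤s j<n)))) ,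
  unrelated-increasingY (f ∘ suc) n (λ i 1+i<n → inc (suc i) (s≤s 1+i<n))

-- Row r has the ℓ r tiles
-- (X r + t , r), t < ℓ r; tile (r , t) is G_{1 + N r + t}, and its contracted edge lies at
-- height contractedY r t.

module HourglassSnake (conv : Convention) (Ls : List ℕ) (1≤k : 1 ≤ length Ls)
  (ℓ≥2 : ∀ {r} → r < length Ls → 2 ≤ lookup₀ Ls r)
  (seam-north : ∀ r → suc r < length Ls → cNorth conv (suc (prefixSum (lookup₀ Ls) r + (lookup₀ Ls r ∸ 1))) ≡ true)
  where

  k : ℕ
  k = length Ls

  ℓ : ℕ → ℕ
  ℓ = lookup₀ Ls

  X : ℕ → ℕ
  X = columnStart Ls

  N : ℕ → ℕ
  N = prefixSum ℓ

  north : ℕ → ℕ → Bool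
  north r t = cNorth conv (suc (N r + t))

  contractedY : ℕ → ℕ → ℕ
  contractedY r t = if north r t then suc r else r

  north-suc : ∀ r t → north r (suc t) ≡ not (north r t)
  north-suc r t = trans (cong (λ n → cNorth conv (suc n)) (+-suc (N r) t)) (cNorth-suc conv (suc (N r + t)))

  north-suc-suc : ∀ r t → north r (suc (suc t)) ≡ north r t
  north-suc-suc r t = trans (north-suc r (suc t)) (trans (cong not (north-suc r t)) (not-involutive _))

  ℓ₂ : ℕ → ℕ
  ℓ₂ r = ℓ r ∸ 2

  ℓ≡2+ℓ₂ : ∀ {r} → r < k → ℓ r ≡ suc (suc (ℓ₂ r))
  ℓ≡2+ℓ₂ {r} r<k = sym (trans (+-comm 2 (ℓ r ∸ 2)) (m∸n+n≡m (ℓ≥2 r<k)))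

  ℓ∸1≡1+ℓ₂ : ∀ {r} → r < k → ℓ r ∸ 1 ≡ suc (ℓ₂ r)
  ℓ∸1≡1+ℓ₂ r<k = cong (_∸ 1) (ℓ≡2+ℓ₂ r<k)

  ℓ≡1+ℓ∸1 : ∀ {r} → r < k → ℓ r ≡ suc (ℓ r ∸ 1)
  ℓ≡1+ℓ∸1 r<k = trans (ℓ≡2+ℓ₂ r<k) (cong suc (sym (ℓ∸1≡1+ℓ₂ r<k)))

  ℓ≢0 : ∀ {r} → r < k → 0 ≢ ℓ r
  ℓ≢0 r<k 0≡ℓ = <-irrefl 0≡ℓ (≤-trans (s≤s z≤n) (ℓ≥2 r<k))

  X-suc : ∀ {r} → r < k → X (suc r) ≡ X r + suc (ℓ₂ r)
  X-suc {r} r<k = cong (X r +_) (ℓ∸1≡1+ℓ₂ r<k)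

  N-suc : ∀ {r} → r < k → N (suc r) ≡ suc (N r + suc (ℓ₂ r))
  N-suc {r} r<k = trans (cong (N r +_) (ℓ≡2+ℓ₂ r<k)) (+-suc (N r) (suc (ℓ₂ r)))

  north-last : ∀ {r} → suc r < k → north r (suc (ℓ₂ r)) ≡ true
  north-last {r} 1+r<k = trans (cong (north r) (sym (ℓ∸1≡1+ℓ₂ (≤-trans (n≤1+n _) 1+r<k)))) (seam-north r 1+r<k)

  north-first : ∀ {r} → suc r < k → north (suc r) 0 ≡ false
  north-first {r} 1+r<k =
    trans (cong (λ n → cNorth conv (suc n)) (trans (+-identityʳ (N (suc r))) (N-suc (≤-trans (n≤1+n _) 1+r<k))))
          (trans (cNorth-suc conv _) (cong not (north-last 1+r<k)))

  north-prelast : ∀ {r} → suc r < k → north r (ℓ₂ r) ≡ false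
  north-prelast {r} 1+r<k =
    trans (sym (not-involutive _)) (trans (cong not (sym (north-suc r (ℓ₂ r)))) (cong not (north-last 1+r<k)))

  N≡X+r : ∀ r → r ≤ k → N r ≡ X r + r
  N≡X+r zero _ = refl
  N≡X+r (suc r) r<k = begin
    N r + ℓ r                   ≡⟨ cong (_+ ℓ r) (N≡X+r r (≤-trans (n≤1+n r) r<k)) ⟩
    X r + r + ℓ r               ≡⟨ cong (X r + r +_) (ℓ≡2+ℓ₂ r<k) ⟩
    X r + r + suc (suc (ℓ₂ r))  ≡⟨ regroup (X r) r (ℓ₂ r) ⟩
    X r + suc (ℓ₂ r) + suc r    ≡⟨ cong (λ c → X r + c + suc r) (sym (ℓ∸1≡1+ℓ₂ r<k)) ⟩
    X (suc r) + suc r           ∎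
    where
    open ≡-Reasoning
    regroup : ∀ a b c → a + b + suc (suc c) ≡ a + suc c + suc b
    regroup = solve-∀

  X-<-suc : ∀ {r} → r < k → X r < X (suc r)
  X-<-suc {r} r<k = ≤-trans (≤-reflexive (+-comm 1 (X r))) (≤-trans (+-monoʳ-≤ (X r) (s≤s z≤n)) (≤-reflexive (sym (X-suc r<k))))

  X-mono-≤ : ∀ {q r} → q ≤ r → r ≤ k → X q ≤ X r
  X-mono-≤ {q} q≤r r≤k with m≤n⇒∃[o]m+o≡n q≤r
  ... | o , refl = go o r≤k
    where
    go : ∀ o → q + o ≤ k → X q ≤ X (q + o)
    go zero _ = ≤-reflexive (cong X (sym (+-identityʳ q)))
    go (suc o) q+o<k = ≤-trans (go o (<⇒≤ q+o<k′)) (≤-trans (<⇒≤ (X-<-suc q+o<k′)) (≤-reflexive (cong X (sym (+-suc q o)))))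
      where
      q+o<k′ : q + o < k
      q+o<k′ = ≤-trans (≤-reflexive (sym (+-suc q o))) q+o<k

  column≤ : ∀ {r t} → r < k → t < ℓ r → X r + t ≤ X k
  column≤ {r} {t} r<k t<ℓ = ≤-trans (+-monoʳ-≤ (X r) (≤-pred (≤-trans t<ℓ (≤-reflexive (ℓ≡2+ℓ₂ r<k)))))
    (≤-trans (≤-reflexive (sym (X-suc r<k))) (X-mono-≤ r<k ≤-refl))

  k≡1+k∸1 : k ≡ suc (k ∸ 1)
  k≡1+k∸1 = sym (trans (+-comm 1 (k ∸ 1)) (m∸n+n≡m 1≤k))

  column-decomp : ∀ x → x ≤ X k → ∃[ r ] ∃[ t ] (r < k × t < ℓ r × X r + t ≡ x)
  column-decomp x x≤ = go (k ∸ 1) (≤-reflexive (sym k≡1+k∸1)) (≤-trans x≤ (≤-reflexive (cong X k≡1+k∸1)))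
    where
    go : ∀ m → suc m ≤ k → x ≤ X (suc m) → ∃[ r ] ∃[ t ] (r < k × t < ℓ r × X r + t ≡ x)
    go zero 1≤k x≤ = 0 , x , 1≤k , ≤-trans (s≤s (≤-trans x≤ (≤-reflexive (X-suc 1≤k)))) (≤-reflexive (sym (ℓ≡2+ℓ₂ 1≤k))) , refl
    go (suc m) m<k x≤ with x ≤? X (suc m)
    ... | yes x≤′ = go m (≤-trans (n≤1+n _) m<k) x≤′
    ... | no x≰ = suc m , x ∸ X (suc m) , m<k , t<ℓ , m+[n∸m]≡n (<⇒≤ (≰⇒> x≰))
      where
      t<ℓ : x ∸ X (suc m) < ℓ (suc m)
      t<ℓ = ≤-trans (s≤s (∸-monoˡ-≤ (X (suc m)) (≤-trans x≤ (≤-reflexive (X-suc m<k)))))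
              (≤-trans (s≤s (≤-reflexive (m+n∸m≡n (X (suc m)) (suc (ℓ₂ (suc m)))))) (≤-reflexive (sym (ℓ≡2+ℓ₂ m<k))))

  -- the last row containing column x: the number of seams X (q + 1), q < k − 1, at or before x
  rowAt : ℕ → ℕ
  rowAt x = sum (applyUpTo (λ q → if X (suc q) ≤ᵇ x then 1 else 0) (k ∸ 1))

  rowAt-eq : ∀ {r x} → r < k → X r ≤ x → (suc r < k → x < X (suc r)) → rowAt x ≡ r
  rowAt-eq {r} {x} r<k X≤x x<X = trans (sum-applyUpTo-cong (k ∸ 1) seam) (count (k ∸ 1) r (≤-pred (≤-trans r<k (≤-reflexive k≡1+k∸1))))
    where
    count : ∀ m r → r ≤ m → sum (applyUpTo (λ q → if q <ᵇ r then 1 else 0) m) ≡ r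
    count m zero _ = sum-applyUpTo-zero _ m (λ _ _ → refl)
    count (suc m) (suc r) (s≤s r≤m) = cong suc (count m r r≤m)
    seam : ∀ q → q < k ∸ 1 → (if X (suc q) ≤ᵇ x then 1 else 0) ≡ (if q <ᵇ r then 1 else 0)
    seam q q< with q <? r
    ... | yes q<r rewrite ≤ᵇ-true (≤-trans (X-mono-≤ q<r (<⇒≤ r<k)) X≤x) | <ᵇ-true q<r = refl
    ... | no q≮r rewrite <ᵇ-false q≮r =
      cong (λ b → if b then 1 else 0) (≤ᵇ-false (λ X≤ → <-irrefl refl (≤-trans (x<X 1+r<k) (≤-trans (X-mono-≤ (s≤s (≮⇒≥ q≮r)) 1+q≤k) X≤))))
      where
      2+q≤k : suc (suc q) ≤ k
      2+q≤k = ≤-trans (s≤s q<) (≤-reflexive (sym k≡1+k∸1))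
      1+q≤k : suc q ≤ k
      1+q≤k = ≤-trans (n≤1+n _) 2+q≤k
      1+r<k : suc r < k
      1+r<k = ≤-trans (s≤s (s≤s (≮⇒≥ q≮r))) 2+q≤k

  -- Every column x ≤ X k carries exactly one contracted edge; at a seam both tiles contract
  -- their common edge.
  contractedYAt : ℕ → ℕ
  contractedYAt x = contractedY (rowAt x) (x ∸ X (rowAt x))

  before-seam : ∀ {r t} → r < k → t < ℓ r → t ≢ suc (ℓ₂ r) → X r + t < X (suc r)
  before-seam {r} r<k t<ℓ t≢ = ≤-trans (+-monoʳ-< (X r) (≤∧≢⇒< (≤-pred (≤-trans t<ℓ (≤-reflexive (ℓ≡2+ℓ₂ r<k)))) t≢)) (≤-reflexive (sym (X-suc r<k)))

  contractedYAt-tile : ∀ {r t} → r < k → t < ℓ r → contractedYAt (X r + t) ≡ contractedY r t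
  contractedYAt-tile {r} {t} r<k t<ℓ with suc r <? k | t ≟ suc (ℓ₂ r)
  ... | yes 1+r<k | yes refl = begin
    contractedYAt (X r + suc (ℓ₂ r))               ≡⟨ cong contractedYAt (sym (X-suc r<k)) ⟩
    contractedYAt (X (suc r))                      ≡⟨ cong (λ q → contractedY q (X (suc r) ∸ X q)) (rowAt-eq 1+r<k ≤-refl (λ _ → X-<-suc 1+r<k)) ⟩
    contractedY (suc r) (X (suc r) ∸ X (suc r))    ≡⟨ cong (contractedY (suc r)) (n∸n≡0 (X (suc r))) ⟩
    contractedY (suc r) 0                          ≡⟨ cong (λ b → if b then suc (suc r) else suc r) (north-first 1+r<k) ⟩
    suc r                                          ≡⟨ cong (λ b → if b then suc r else r) (north-last 1+r<k) ⟨
    contractedY r (suc (ℓ₂ r))                     ∎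
    where open ≡-Reasoning
  ... | yes 1+r<k | no t≢ rewrite rowAt-eq {r} {X r + t} r<k (m≤m+n (X r) t) (λ _ → before-seam r<k t<ℓ t≢) | m+n∸m≡n (X r) t = refl
  ... | no 1+r≮k | _ rewrite rowAt-eq {r} {X r + t} r<k (m≤m+n (X r) t) (⊥-elim ∘ 1+r≮k) | m+n∸m≡n (X r) t = refl

  contractedY-parity : ∀ r t → r ≤ k → isOdd (contractedY r t + (X r + t)) ≡ cNorth conv 1
  contractedY-parity r t r≤k = trans (cong isOdd index) (cNorth-parity conv (N r + t))
    where
    index : contractedY r t + (X r + t) ≡ N r + t + (if north r t then 1 else 0)
    index with north r t
    ... | true = trans (regroup (X r) r t) (cong (λ n → n + t + 1) (sym (N≡X+r r r≤k)))
      where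
      regroup : ∀ a b c → suc b + (a + c) ≡ a + b + c + 1
      regroup = solve-∀
    ... | false = trans (regroup (X r) r t) (cong (λ n → n + t + 0) (sym (N≡X+r r r≤k)))
      where
      regroup : ∀ a b c → b + (a + c) ≡ a + b + c + 0
      regroup = solve-∀

  contractedYAt-parity : ∀ x → x ≤ X k → isOdd (contractedYAt x + x) ≡ cNorth conv 1
  contractedYAt-parity x x≤ with column-decomp x x≤
  ... | r , t , r<k , t<ℓ , refl = trans (cong (λ y → isOdd (y + (X r + t))) (contractedYAt-tile r<k t<ℓ)) (contractedY-parity r t (<⇒≤ r<k))

  -- so no two contracted edges are adjacent, and contraction moves a corner at most one column west
  contractedYAt-adjacent : ∀ x → suc x ≤ X k → contractedYAt (suc x) ≢ contractedYAt x
  contractedYAt-adjacent x 1+x≤ same = not-≢ (cNorth conv 1)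
    (trans (sym (cong not this)) (trans (sym (cong isOdd (+-suc (contractedYAt x) x))) (trans (cong (λ y → isOdd (y + suc x)) (sym same)) next)))
    where
    this : isOdd (contractedYAt x + x) ≡ cNorth conv 1
    this = contractedYAt-parity x (≤-trans (n≤1+n x) 1+x≤)
    next : isOdd (contractedYAt (suc x) + suc x) ≡ cNorth conv 1
    next = contractedYAt-parity (suc x) 1+x≤
    not-≢ : ∀ b → not b ≢ b
    not-≢ true ()
    not-≢ false ()

  perTile : ∀ {A : Set} → (ℕ → ℕ → A) → List A
  perTile = grid ℓ k

  map-perTile : ∀ {A B : Set} (f : A → B) (g : ℕ → ℕ → A) → map f (perTile g) ≡ perTile (λ r t → f (g r t))
  map-perTile f g = trans (sym (concat-map (applyUpTo (λ r → applyUpTo (g r) (ℓ r)) k)))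
    (cong concat (trans (map-applyUpTo (λ r → applyUpTo (g r) (ℓ r)) (map f) k) (applyUpTo-cong k (λ r _ → map-applyUpTo (g r) f (ℓ r)))))

  perTile-cong : ∀ {A : Set} {g g′ : ℕ → ℕ → A} → (∀ r t → r < k → t < ℓ r → g r t ≡ g′ r t) → perTile g ≡ perTile g′
  perTile-cong g≡g′ = cong concat (applyUpTo-cong k (λ r r<k → applyUpTo-cong (ℓ r) (λ t t<ℓ → g≡g′ r t r<k t<ℓ)))

  All-perTile : ∀ {A : Set} {P : A → Set} (g : ℕ → ℕ → A) → (∀ r t → r < k → t < ℓ r → P (g r t)) → All P (perTile g)
  All-perTile g h = concat⁺ (All-applyUpTo _ k (λ r r<k → All-applyUpTo (g r) (ℓ r) (λ t t<ℓ → h r t r<k t<ℓ)))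

  ∈-perTile : ∀ {A : Set} (g : ℕ → ℕ → A) r t → r < k → t < ℓ r → g r t ∈ perTile g
  ∈-perTile g r t r<k t<ℓ = ∈-concat⁺′ (∈-applyUpTo⁺ (g r) t<ℓ) (∈-applyUpTo⁺ (λ r → applyUpTo (g r) (ℓ r)) r<k)

  -- Contraction

  tiles : List Point
  tiles = hourglassTiles Ls

  indexFrom-tiles : indexFrom 1 tiles ≡ perTile (λ r t → (suc (N r + t) , (X r + t , r)))
  indexFrom-tiles = indexFrom-grid 1 ℓ k (λ r t → (X r + t , r))

  contracted : List Point
  contracted = contractedEdges conv tiles

  contracted-perTile : contracted ≡ perTile (λ r t → (X r + t , contractedY r t))
  contracted-perTile = trans (cong (map _) indexFrom-tiles) (trans (map-perTile _ _) (perTile-cong (λ r t _ _ → if-north (X r + t) r (north r t))))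
    where
    if-north : ∀ (x y : ℕ) b → (if b then (x , suc y) else (x , y)) ≡ (x , (if b then suc y else y))
    if-north x y true = refl
    if-north x y false = refl

  isContracted-true : ∀ x → x ≤ X k → ((x , contractedYAt x) ∈ᵇ contracted) ≡ true
  isContracted-true x x≤ with column-decomp x x≤
  ... | r , t , r<k , t<ℓ , refl =
    any-true _ contracted (subst ((X r + t , contractedY r t) ∈_) (sym contracted-perTile) (∈-perTile _ r t r<k t<ℓ))
      (cong₂ _∧_ (≡ᵇ-true {X r + t} refl) (≡ᵇ-true (sym (contractedYAt-tile r<k t<ℓ))))

  isContracted-false : ∀ x y → (x ≤ X k → y ≢ contractedYAt x) → ((x , y) ∈ᵇ contracted) ≡ false
  isContracted-false x y y≢ = any-false _ contracted (subst (All _) (sym contracted-perTile) (All-perTile _ other))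
    where
    other : ∀ r t → r < k → t < ℓ r → ((X r + t , contractedY r t) ==ᵖ (x , y)) ≡ false
    other r t r<k t<ℓ with X r + t ≟ x
    ... | no ≢x rewrite ≡ᵇ-false ≢x = refl
    ... | yes refl rewrite ≡ᵇ-true {X r + t} refl = ≡ᵇ-false (λ e → y≢ (column≤ r<k t<ℓ) (trans (sym e) (sym (contractedYAt-tile r<k t<ℓ))))

  repr : Point → Point
  repr = rep contracted

  repr-fixed : ∀ x y → (x ≤ X k → y ≢ contractedYAt x) → repr (suc x , y) ≡ (suc x , y)
  repr-fixed x y y≢ rewrite isContracted-false x y y≢ = refl

  repr-contractedWest : ∀ x → x ≤ X k → repr (x , contractedYAt x) ≡ (x , contractedYAt x)
  repr-contractedWest zero _ = refl
  repr-contractedWest (suc x) 1+x≤ = repr-fixed x (contractedYAt (suc x)) (λ _ → contractedYAt-adjacent x 1+x≤)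

  repr-contractedEast : ∀ x → x ≤ X k → repr (suc x , contractedYAt x) ≡ (x , contractedYAt x)
  repr-contractedEast x x≤ rewrite isContracted-true x x≤ = repr-contractedWest x x≤

  -- Arrows

  open Dedup sameGeomEdge
  open Blocks edgeWeight edgeWeight-resp

  tileTriangle : ℕ → ℕ → List Edge
  tileTriangle r t = triangle (north r t) (X r + t , r)

  tileTriangleNoWest : ℕ → ℕ → List Edge
  tileTriangleNoWest r t = triangleNoWest (north r t) (X r + t , r)

  allTriangleEdges : List Edge
  allTriangleEdges = concatMap (triangleEdges conv) (indexFrom 1 tiles)

  allTriangleEdges-perTile : allTriangleEdges ≡ concat (perTile tileTriangle)
  allTriangleEdges-perTile = cong concat (trans (cong (map (triangleEdges conv)) indexFrom-tiles) (map-perTile _ _))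

  -- the edges of a tile's triangle have coordinate sums within 2 (x + y) + [1, 3]
  windowed-triangles : Windowed 0 (perTile tileTriangle)
  windowed-triangles = Windowed-grid 0 ℓ k tileTriangle (λ r t r<k _ →
    subst (λ n → All (InWindow n) (tileTriangle r t)) (index r t r<k)
      (subst (All (InWindow (X r + t + r))) (sym (triangle-translate (north r t) (X r + t) r))
        (map⁺ {f = translateEdge (X r + t , r)} (All.map (λ {e} → translated (X r + t) r {e}) (unit (north r t))))))
    where
    unit : ∀ b → All (λ e → 1 ≤ edgeWeight e × edgeWeight e ≤ 3) (triangle b (0 , 0))
    unit true = (s≤s z≤n , s≤s z≤n) ∷ (s≤s z≤n , s≤s z≤n) ∷ (s≤s z≤n , ≤-refl) ∷ []
    unit false = (s≤s z≤n , ≤-refl) ∷ (s≤s z≤n , s≤s z≤n) ∷ (s≤s z≤n , ≤-refl) ∷ []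
    translated : ∀ x y {e} → 1 ≤ edgeWeight e × edgeWeight e ≤ 3 → InWindow (x + y) (translateEdge (x , y) e)
    translated x y {e} (1≤ , ≤3) rewrite edgeWeight-translate x y e = +-monoˡ-≤ (2 * (x + y)) 1≤ , +-monoˡ-≤ (2 * (x + y)) ≤3
    index : ∀ r t → r < k → X r + t + r ≡ N r + t
    index r t r<k = trans (+-assoc (X r) t r) (trans (cong (X r +_) (+-comm t r))
      (trans (sym (+-assoc (X r) r t)) (cong (_+ t) (sym (N≡X+r r (<⇒≤ r<k))))))

  private
    keepFresh-translate : ∀ d A B → keepFresh (reverse (map (translateEdge d) A)) (map (translateEdge d) B) ≡
      map (translateEdge d) (keepFresh (reverse A) B)
    keepFresh-translate d A B = trans (cong (λ s → keepFresh s (map (translateEdge d) B)) (sym (map-ʳ++ (translateEdge d) A)))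
      (keepFresh-map (translateEdge d) (sameGeomEdge-translate d) (reverse A) B)

  keepFresh-vertical : ∀ x y → keepFresh (reverse (triangle true (x , y))) (triangle false (x , suc y)) ≡ triangle false (x , suc y)
  keepFresh-vertical x y rewrite triangle-translate true x y | triangle-translate-north false x y =
    keepFresh-translate (x , y) (triangle true (0 , 0)) (triangle false (0 , 1))

  keepFresh-horizontal : ∀ b x y → keepFresh (reverse (triangle b (x , y))) (triangle (not b) (suc x , y)) ≡ triangleNoWest (not b) (suc x , y)
  keepFresh-horizontal true x y rewrite triangle-translate true x y | triangle-translate-east false x y | triangleNoWest-translate-east false x y =
    keepFresh-translate (x , y) (triangle true (0 , 0)) (triangle false (1 , 0))
  keepFresh-horizontal false x y rewrite triangle-translate false x y | triangle-translate-east true x y | triangleNoWest-translate-east true x y =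
    keepFresh-translate (x , y) (triangle false (0 , 0)) (triangle true (1 , 0))

  keepFresh-rowStart : ∀ r → r < k → keepFresh (previousBlock ℓ tileTriangle [] r) (tileTriangle r 0) ≡ tileTriangle r 0
  keepFresh-rowStart zero _ = first (north 0 0)
    where
    first : ∀ b → keepFresh [] (triangle b (0 , 0)) ≡ triangle b (0 , 0)
    first true = refl
    first false = refl
  keepFresh-rowStart (suc r) 1+r<k rewrite +-identityʳ (X (suc r)) | seam-north r 1+r<k | north-first 1+r<k =
    keepFresh-vertical (X (suc r)) r

  keepFresh-inRow : ∀ r t → keepFresh (reverse (tileTriangle r t)) (tileTriangle r (suc t)) ≡ tileTriangleNoWest r (suc t)
  keepFresh-inRow r t rewrite +-suc (X r) t | north-suc r t = keepFresh-horizontal (north r t) (X r + t) r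

  deduplicate-triangles : deduplicateᵇ sameGeomEdge allTriangleEdges ≡
    concat (concat (applyUpTo (λ r → tileTriangle r 0 ∷ applyUpTo (λ t → tileTriangleNoWest r (suc t)) (ℓ r ∸ 1)) k))
  deduplicate-triangles = begin
    deduplicateᵇ sameGeomEdge allTriangleEdges
      ≡⟨ cong (deduplicateᵇ sameGeomEdge) allTriangleEdges-perTile ⟩
    deduplicateᵇ sameGeomEdge (concat (perTile tileTriangle))
      ≡⟨ deduplicateᵇ-blocks (perTile tileTriangle) windowed-triangles ⟩
    concat (keepFreshBlocks [] (perTile tileTriangle))
      ≡⟨ cong concat (keepFreshBlocks-grid ℓ k tileTriangle [] (λ r r<k → ≤-trans (s≤s z≤n) (ℓ≥2 r<k))) ⟩
    concat (concat (applyUpTo (λ r → keepFresh (previousBlock ℓ tileTriangle [] r) (tileTriangle r 0)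
                                   ∷ applyUpTo (λ t → keepFresh (reverse (tileTriangle r t)) (tileTriangle r (suc t))) (ℓ r ∸ 1)) k))
      ≡⟨ cong (concat ∘ concat) (applyUpTo-cong k (λ r r<k → cong₂ _∷_ (keepFresh-rowStart r r<k) (applyUpTo-cong (ℓ r ∸ 1) (λ t _ → keepFresh-inRow r t)))) ⟩
    concat (concat (applyUpTo (λ r → tileTriangle r 0 ∷ applyUpTo (λ t → tileTriangleNoWest r (suc t)) (ℓ r ∸ 1)) k)) ∎
    where open ≡-Reasoning

  -- Row r of the contracted graph is the fan on node r 0, …, node r (ℓ r + 1): node r (1 + t)
  -- is the contracted edge of tile (r , t), and the free horizontal edge of that tile runs
  -- from node r t to node r (2 + t).

  freeY : ℕ → ℕ → ℕ
  freeY r t = if north r t then r else suc r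

  node : ℕ → ℕ → Point
  node r zero = (X r , freeY r 0)
  node r (suc i) = (X r + i , contractedY r i)

  freeY-suc : ∀ r t → freeY r (suc t) ≡ contractedY r t
  freeY-suc r t rewrite north-suc r t with north r t
  ... | true = refl
  ... | false = refl

  contractedY-suc : ∀ r t → contractedY r (suc t) ≡ freeY r t
  contractedY-suc r t rewrite north-suc r t with north r t
  ... | true = refl
  ... | false = refl

  freeY≢contractedY : ∀ r t → freeY r t ≢ contractedY r t
  freeY≢contractedY r t with north r t
  ... | true = n≢1+n r
  ... | false = n≢1+n r ∘ sym

  triangle-tile : ∀ r t → tileTriangle r t ≡
    ((X r + t , freeY r t) , (suc (X r + t) , freeY r t)) ∷ ((X r + t , freeY r t) , (X r + t , contractedY r t))
      ∷ ((suc (X r + t) , contractedY r t) , (suc (X r + t) , freeY r t)) ∷ []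
  triangle-tile r t with north r t
  ... | true = refl
  ... | false = refl

  triangleNoWest-tile : ∀ r t → tileTriangleNoWest r t ≡
    ((X r + t , freeY r t) , (suc (X r + t) , freeY r t)) ∷ ((suc (X r + t) , contractedY r t) , (suc (X r + t) , freeY r t)) ∷ []
  triangleNoWest-tile r t with north r t
  ... | true = refl
  ... | false = refl

  repr-contracted-w : ∀ {r t} → r < k → t < ℓ r → repr (X r + t , contractedY r t) ≡ node r (suc t)
  repr-contracted-w {r} {t} r<k t<ℓ = trans (cong (λ y → repr (X r + t , y)) (sym (contractedYAt-tile r<k t<ℓ)))
    (trans (repr-contractedWest (X r + t) (column≤ r<k t<ℓ)) (cong (X r + t ,_) (contractedYAt-tile r<k t<ℓ)))

  repr-contracted-e : ∀ {r t} → r < k → t < ℓ r → repr (suc (X r + t) , contractedY r t) ≡ node r (suc t)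
  repr-contracted-e {r} {t} r<k t<ℓ = trans (cong (λ y → repr (suc (X r + t) , y)) (sym (contractedYAt-tile r<k t<ℓ)))
    (trans (repr-contractedEast (X r + t) (column≤ r<k t<ℓ)) (cong (X r + t ,_) (contractedYAt-tile r<k t<ℓ)))

  repr-free-e : ∀ {r t} → r < k → t < ℓ r → repr (suc (X r + t) , freeY r t) ≡ node r (suc (suc t))
  repr-free-e {r} {t} r<k t<ℓ =
    trans (repr-fixed (X r + t) (freeY r t) (λ _ e → freeY≢contractedY r t (trans e (contractedYAt-tile r<k t<ℓ))))
          (cong₂ _,_ (sym (+-suc (X r) t)) (sym (contractedY-suc r t)))

  repr-free-w : ∀ {r t} → r < k → t < ℓ r → repr (X r + t , freeY r t) ≡ node r t
  repr-free-w {zero} {zero} _ _ = refl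
  repr-free-w {suc r} {zero} 1+r<k _ rewrite +-identityʳ (X (suc r)) | X-suc (≤-trans (n≤1+n _) 1+r<k) | +-suc (X r) (ℓ₂ r) =
    repr-fixed (X r + ℓ₂ r) (freeY (suc r) 0) (λ _ e → freeY≢ (trans e
      (trans (contractedYAt-tile r<k (≤-trans (n≤1+n _) (≤-reflexive (sym (ℓ≡2+ℓ₂ r<k)))))
             (cong (λ b → if b then suc r else r) (north-prelast 1+r<k)))))
    where
    r<k : r < k
    r<k = ≤-trans (n≤1+n _) 1+r<k
    freeY≢ : freeY (suc r) 0 ≢ r
    freeY≢ with north (suc r) 0
    ... | true = n≢1+n r ∘ sym
    ... | false = n≢2+n r ∘ sym
  repr-free-w {r} {suc t} r<k 1+t<ℓ rewrite +-suc (X r) t | freeY-suc r t = repr-contracted-e r<k (≤-trans (n≤1+n _) 1+t<ℓ)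

  reprEdge : Edge → Edge
  reprEdge (a , b) = (repr a , repr b)

  triangle-nodes : ∀ {r t} → r < k → t < ℓ r → map reprEdge (tileTriangle r t) ≡
    (node r t , node r (suc (suc t))) ∷ (node r t , node r (suc t)) ∷ (node r (suc t) , node r (suc (suc t))) ∷ []
  triangle-nodes {r} {t} r<k t<ℓ = trans (cong (map reprEdge) (triangle-tile r t))
    (cong₂ _∷_ (cong₂ _,_ (repr-free-w r<k t<ℓ) (repr-free-e r<k t<ℓ))
    (cong₂ _∷_ (cong₂ _,_ (repr-free-w r<k t<ℓ) (repr-contracted-w r<k t<ℓ))
    (cong₂ _∷_ (cong₂ _,_ (repr-contracted-e r<k t<ℓ) (repr-free-e r<k t<ℓ)) refl)))

  triangleNoWest-nodes : ∀ {r t} → r < k → t < ℓ r → map reprEdge (tileTriangleNoWest r t) ≡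
    (node r t , node r (suc (suc t))) ∷ (node r (suc t) , node r (suc (suc t))) ∷ []
  triangleNoWest-nodes {r} {t} r<k t<ℓ = trans (cong (map reprEdge) (triangleNoWest-tile r t))
    (cong₂ _∷_ (cong₂ _,_ (repr-free-w r<k t<ℓ) (repr-free-e r<k t<ℓ))
    (cong₂ _∷_ (cong₂ _,_ (repr-contracted-e r<k t<ℓ) (repr-free-e r<k t<ℓ)) refl))

  nodeArcs : List Edge
  nodeArcs = concat (applyUpTo (λ r → concat (Fan.fanArcs (node r) (ℓ r))) k)

  arrows-nodeArcs : arrows conv tiles ≡ nodeArcs
  arrows-nodeArcs = begin
    arrows conv tiles
      ≡⟨ map-cong (λ { (a , b) → refl }) _ ⟩
    map reprEdge (deduplicateᵇ sameGeomEdge allTriangleEdges)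
      ≡⟨ cong (map reprEdge) deduplicate-triangles ⟩
    map reprEdge (concat (concat triangles))
      ≡⟨ concat-map (concat triangles) ⟨
    concat (map (map reprEdge) (concat triangles))
      ≡⟨ cong concat (concat-map triangles) ⟨
    concat (concat (map (map (map reprEdge)) triangles))
      ≡⟨ cong (concat ∘ concat) (trans (map-applyUpTo _ _ k) (applyUpTo-cong k (λ r r<k →
           cong₂ _∷_ (triangle-nodes r<k (≤-trans (s≤s z≤n) (ℓ≥2 r<k)))
                     (trans (map-applyUpTo _ _ (ℓ r ∸ 1)) (applyUpTo-cong (ℓ r ∸ 1) (λ t t< →
                       triangleNoWest-nodes r<k (≤-trans (s≤s t<) (≤-reflexive (sym (ℓ≡1+ℓ∸1 r<k)))))))))) ⟩
    concat (concat (applyUpTo (λ r → Fan.fanArcs (node r) (ℓ r)) k))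
      ≡⟨ concat-concat (applyUpTo (λ r → Fan.fanArcs (node r) (ℓ r)) k) ⟨
    concat (map concat (applyUpTo (λ r → Fan.fanArcs (node r) (ℓ r)) k))
      ≡⟨ cong concat (map-applyUpTo _ concat k) ⟩
    nodeArcs ∎
    where
    open ≡-Reasoning
    triangles : List (List (List Edge))
    triangles = applyUpTo (λ r → tileTriangle r 0 ∷ applyUpTo (λ t → tileTriangleNoWest r (suc t)) (ℓ r ∸ 1)) k

  -- Abstract vertices: (r , i) stands for node r i.  At a seam node r (ℓ r) = node (r + 1) 1,
  -- and canonical picks the second name.

  Vertex : Set
  Vertex = ℕ × ℕ

  canonical : ℕ → ℕ → Vertex
  canonical r i = if (i ≡ᵇ ℓ r) ∧ (suc r <ᵇ k) then (suc r , 1) else (r , i)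

  nodeAt : Vertex → Point
  nodeAt (r , i) = node r i

  canonical-other : ∀ {r i} → ¬ (i ≡ ℓ r × suc r < k) → canonical r i ≡ (r , i)
  canonical-other {r} {i} not-seam with i ≟ ℓ r | suc r <? k
  ... | yes i≡ℓ | yes 1+r<k = ⊥-elim (not-seam (i≡ℓ , 1+r<k))
  ... | yes i≡ℓ | no 1+r≮k rewrite ≡ᵇ-true i≡ℓ | <ᵇ-false 1+r≮k = refl
  ... | no i≢ℓ | _ rewrite ≡ᵇ-false i≢ℓ = refl

  canonical-seam : ∀ {r} → suc r < k → canonical r (ℓ r) ≡ (suc r , 1)
  canonical-seam {r} 1+r<k rewrite ≡ᵇ-true {ℓ r} refl | <ᵇ-true 1+r<k = refl

  nodeAt-canonical : ∀ {r} i → r < k → nodeAt (canonical r i) ≡ node r i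
  nodeAt-canonical {r} i r<k with i ≟ ℓ r | suc r <? k
  ... | yes refl | yes 1+r<k rewrite canonical-seam 1+r<k = begin
    node (suc r) 1            ≡⟨ cong₂ _,_ (+-identityʳ _) (cong (λ b → if b then suc (suc r) else suc r) (north-first 1+r<k)) ⟩
    (X (suc r) , suc r)       ≡⟨ cong₂ _,_ (X-suc r<k) (cong (λ b → if b then suc r else r) (sym (north-last 1+r<k))) ⟩
    node r (suc (suc (ℓ₂ r))) ≡⟨ cong (node r) (ℓ≡2+ℓ₂ r<k) ⟨
    node r (ℓ r)              ∎
    where open ≡-Reasoning
  ... | yes _ | no 1+r≮k rewrite canonical-other {r} {i} (1+r≮k ∘ proj₂) = refl
  ... | no i≢ℓ | _ rewrite canonical-other {r} {i} (i≢ℓ ∘ proj₁) = refl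

  Valid : Vertex → Set
  Valid (r , i) = r < k × i ≤ suc (ℓ r) × ¬ (i ≡ ℓ r × suc r < k)

  height : Vertex → ℕ
  height (r , i) = X r + i

  canonical-valid : ∀ {r i} → r < k → i ≤ suc (ℓ r) → Valid (canonical r i)
  canonical-valid {r} {i} r<k i≤ with i ≟ ℓ r | suc r <? k
  ... | yes refl | yes 1+r<k rewrite canonical-seam 1+r<k = 1+r<k , s≤s z≤n , (λ { (1≡ℓ , _) → 1≢ℓ 1≡ℓ (ℓ≥2 1+r<k) })
    where
    1≢ℓ : ∀ {m} → 1 ≡ m → ¬ (2 ≤ m)
    1≢ℓ refl (s≤s ())
  ... | yes _ | no 1+r≮k rewrite canonical-other {r} {i} (1+r≮k ∘ proj₂) = r<k , i≤ , 1+r≮k ∘ proj₂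
  ... | no i≢ℓ | _ rewrite canonical-other {r} {i} (i≢ℓ ∘ proj₁) = r<k , i≤ , i≢ℓ ∘ proj₁

  canonical-height : ∀ {r i} → r < k → height (canonical r i) ≡ X r + i
  canonical-height {r} {i} r<k with i ≟ ℓ r | suc r <? k
  ... | yes refl | yes 1+r<k rewrite canonical-seam 1+r<k =
    trans (cong (_+ 1) (X-suc r<k)) (trans (regroup (X r) (ℓ₂ r)) (cong (X r +_) (sym (ℓ≡2+ℓ₂ r<k))))
    where
    regroup : ∀ a b → a + suc b + 1 ≡ a + suc (suc b)
    regroup = solve-∀
  ... | yes _ | no 1+r≮k rewrite canonical-other {r} {i} (1+r≮k ∘ proj₂) = refl
  ... | no i≢ℓ | _ rewrite canonical-other {r} {i} (i≢ℓ ∘ proj₁) = refl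

  canonical-index≥1 : ∀ r j → 1 ≤ j → 1 ≤ proj₂ (canonical r j)
  canonical-index≥1 r j 1≤j with j ≟ ℓ r | suc r <? k
  ... | yes refl | yes 1+r<k rewrite canonical-seam 1+r<k = s≤s z≤n
  ... | yes _ | no 1+r≮k rewrite canonical-other {r} {j} (1+r≮k ∘ proj₂) = 1≤j
  ... | no j≢ℓ | _ rewrite canonical-other {r} {j} (j≢ℓ ∘ proj₁) = 1≤j

  arcs : List (Vertex × Vertex)
  arcs = concat (applyUpTo (λ r → concat (Fan.fanArcs (canonical r) (ℓ r))) k)

  embedArc : Vertex × Vertex → Edge
  embedArc e = (nodeAt (proj₁ e) , nodeAt (proj₂ e))

  embed-arcs : map embedArc arcs ≡ nodeArcs
  embed-arcs = begin
    map embedArc (concat fans)                   ≡⟨ concat-map fans ⟨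
    concat (map (map embedArc) fans)             ≡⟨ cong concat (trans (map-applyUpTo _ _ k) (applyUpTo-cong k fan)) ⟩
    nodeArcs ∎
    where
    open ≡-Reasoning
    fans : List (List (Vertex × Vertex))
    fans = applyUpTo (λ r → concat (Fan.fanArcs (canonical r) (ℓ r))) k
    fan : ∀ r → r < k → map embedArc (concat (Fan.fanArcs (canonical r) (ℓ r))) ≡ concat (Fan.fanArcs (node r) (ℓ r))
    fan r r<k = subst (λ L → map embedArc (concat (Fan.fanArcs (canonical r) L)) ≡ concat (Fan.fanArcs (node r) L))
      (sym (ℓ≡1+ℓ∸1 r<k))
      (trans (sym (concat-map (Fan.fanArcs (canonical r) (suc (ℓ r ∸ 1)))))
        (cong concat (trans (fanArcs-map nodeAt (canonical r) (suc (ℓ r ∸ 1))) (fanArcs-cong (ℓ r ∸ 1) (λ i _ → nodeAt-canonical i r<k)))))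

  All-arcs : ∀ {P : Vertex × Vertex → Set} →
    (∀ r j j′ → r < k → j < j′ → j′ ≤ suc (ℓ r) → j ≤ ℓ r → P (canonical r j , canonical r j′)) → All P arcs
  All-arcs {P} P-arc = concat⁺ (All-applyUpTo _ k fan)
    where
    fan : ∀ r → r < k → All P (concat (Fan.fanArcs (canonical r) (ℓ r)))
    fan r r<k = subst (λ L → All P (concat (Fan.fanArcs (canonical r) L))) (sym ℓ≡)
      (All-fanArcs (canonical r) (ℓ r ∸ 1) (λ j j′ j<j′ j′≤ j≤ →
        P-arc r j j′ r<k j<j′ (subst (j′ ≤_) (cong suc (sym ℓ≡)) j′≤) (subst (j ≤_) (sym ℓ≡) j≤)))
      where
      ℓ≡ : ℓ r ≡ suc (ℓ r ∸ 1)
      ℓ≡ = ℓ≡1+ℓ∸1 r<k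

  ∈-arcs : ∀ {r m} → r < k → m ≤ ℓ r → (canonical r m , canonical r (suc m)) ∈ arcs
  ∈-arcs {r} {m} r<k m≤ℓ = ∈-concat⁺′ (fan r<k m≤ℓ) (∈-applyUpTo⁺ (λ r → concat (Fan.fanArcs (canonical r) (ℓ r))) r<k)
    where
    fan : r < k → m ≤ ℓ r → (canonical r m , canonical r (suc m)) ∈ concat (Fan.fanArcs (canonical r) (ℓ r))
    fan r<k m≤ℓ = subst (λ L → (canonical r m , canonical r (suc m)) ∈ concat (Fan.fanArcs (canonical r) L)) (sym ℓ≡)
      (∈-fanArcs (canonical r) (ℓ r ∸ 1) m (subst (m ≤_) ℓ≡ m≤ℓ))
      where
      ℓ≡ : ℓ r ≡ suc (ℓ r ∸ 1)
      ℓ≡ = ℓ≡1+ℓ∸1 r<k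

  arcs-ok : All (λ e → Valid (proj₁ e) × Valid (proj₂ e) × height (proj₁ e) < height (proj₂ e)) arcs
  arcs-ok = All-arcs (λ r j j′ r<k j<j′ j′≤ _ → canonical-valid r<k (≤-trans (<⇒≤ j<j′) j′≤) , canonical-valid r<k j′≤ ,
    subst₂ _<_ (sym (canonical-height r<k)) (sym (canonical-height r<k)) (+-monoʳ-< (X r) j<j′))

  top : ℕ
  top = X k + 2

  sources-below : All (λ e → height (proj₁ e) < top) arcs
  sources-below = All-arcs (λ r j j′ r<k _ _ j≤ℓ → begin-strict
    height (canonical r j)   ≡⟨ canonical-height r<k ⟩
    X r + j                  ≤⟨ +-monoʳ-≤ (X r) j≤ℓ ⟩
    X r + ℓ r                ≡⟨ cong (X r +_) (ℓ≡2+ℓ₂ r<k) ⟩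
    X r + suc (suc (ℓ₂ r))   ≡⟨ +-suc (X r) (suc (ℓ₂ r)) ⟩
    suc (X r + suc (ℓ₂ r))   ≡⟨ cong suc (X-suc {r} r<k) ⟨
    suc (X (suc r))          ≤⟨ s≤s (X-mono-≤ r<k ≤-refl) ⟩
    suc (X k)                <⟨ ≤-refl ⟩
    suc (suc (X k))          ≡⟨ +-comm 2 (X k) ⟩
    top                      ∎)
    where open ≤-Reasoning

  node-y : ∀ r i → proj₂ (node r i) ≡ r ⊎ proj₂ (node r i) ≡ suc r
  node-y r zero with north r 0
  ... | true = inj₁ refl
  ... | false = inj₂ refl
  node-y r (suc i) with north r i
  ... | true = inj₂ refl
  ... | false = inj₁ refl

  node-x≥ : ∀ r i → X r ≤ proj₁ (node r i)
  node-x≥ r zero = ≤-refl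
  node-x≥ r (suc i) = m≤m+n (X r) i

  node-x< : ∀ {r i} → r < k → i < ℓ r → proj₁ (node r i) < X (suc r)
  node-x< {r} {zero} r<k _ = X-<-suc r<k
  node-x< {r} {suc i} r<k 1+i<ℓ =
    ≤-trans (+-monoʳ-< (X r) (≤-pred (≤-trans 1+i<ℓ (≤-reflexive (ℓ≡2+ℓ₂ r<k))))) (≤-reflexive (sym (X-suc r<k)))

  sink-y : ∀ {r} → suc r < k → proj₂ (node r (suc (ℓ r))) ≡ r
  sink-y {r} 1+r<k rewrite ℓ≡2+ℓ₂ (≤-trans (n≤1+n _) 1+r<k) | north-suc-suc r (ℓ₂ r) | north-prelast 1+r<k = refl

  node-injective-row : ∀ r i i′ → node r i ≡ node r i′ → i ≡ i′
  node-injective-row r zero zero _ = refl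
  node-injective-row r (suc i) (suc i′) same = cong suc (+-cancelˡ-≡ (X r) i i′ (cong proj₁ same))
  node-injective-row r zero (suc i′) same with +-cancelˡ-≡ (X r) 0 i′ (trans (+-identityʳ (X r)) (cong proj₁ same))
  ... | refl = ⊥-elim (freeY≢contractedY r 0 (cong proj₂ same))
  node-injective-row r (suc i) zero same = sym (node-injective-row r zero (suc i) (sym same))

  private
    node-injective-< : ∀ r i r′ i′ → Valid (r , i) → Valid (r′ , i′) → r < r′ → node r i ≢ node r′ i′
    node-injective-< r i r′ i′ (r<k , i≤ , not-seam) _ r<r′ same with node-y r i | node-y r′ i′
    ... | inj₁ y | inj₁ y′ = <-irrefl (trans (sym y) (trans (cong proj₂ same) y′)) r<r′
    ... | inj₁ y | inj₂ y′ with trans (sym y) (trans (cong proj₂ same) y′)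
    ...   | refl = <-irrefl refl (≤-trans (n≤1+n _) r<r′)
    node-injective-< r i r′ i′ (r<k , i≤ , not-seam) _ r<r′ same | inj₂ y | inj₂ y′ =
      <-irrefl (suc-injective (trans (sym y) (trans (cong proj₂ same) y′))) r<r′
    node-injective-< r i r′ i′ (r<k , i≤ , not-seam) (r′<k , _) r<r′ same | inj₂ y | inj₁ y′
      with trans (sym y′) (trans (cong proj₂ (sym same)) y)
    ... | refl with <-cmp i (ℓ r)
    ...   | tri< i<ℓ _ _ = <-irrefl refl (≤-trans (node-x< r<k i<ℓ) (≤-trans (node-x≥ (suc r) i′) (≤-reflexive (sym (cong proj₁ same)))))
    ...   | tri≈ _ i≡ℓ _ = not-seam (i≡ℓ , r′<k)
    ...   | tri> _ _ ℓ<i with ≤-antisym i≤ ℓ<i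
    ...     | refl = n≢1+n r (trans (sym (sink-y r′<k)) y)

  node-injective : ∀ a b → Valid a → Valid b → nodeAt a ≡ nodeAt b → a ≡ b
  node-injective (r , i) (r′ , i′) va vb same with <-cmp r r′
  ... | tri< r<r′ _ _ = ⊥-elim (node-injective-< r i r′ i′ va vb r<r′ same)
  ... | tri> _ _ r′<r = ⊥-elim (node-injective-< r′ i′ r i vb va r′<r (sym same))
  ... | tri≈ _ refl _ = cong (r ,_) (node-injective-row r i i′ same)

  open PathCount _==ᵖ_ ==ᵖ-sound ==ᵖ-refl nodeAt Valid node-injective height arcs arcs-ok

  -- the position of (r , i) in the fan of row r′ (ℓ r′ + 1 if it is not there)
  indexIn : ℕ → Vertex → ℕ
  indexIn r′ (r , i) = if r′ ≡ᵇ r then i else (if (suc r′ ≡ᵇ r) ∧ (i ≡ᵇ 1) then ℓ r′ else suc (ℓ r′))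

  private
    ==ᵖ-indexIn : ∀ {r′ j r i} → j ≤ ℓ r′ → r < k → ¬ (j ≡ ℓ r′ × suc r′ < k) → ((r′ , j) ==ᵖ (r , i)) ≡ (j ≡ᵇ indexIn r′ (r , i))
    ==ᵖ-indexIn {r′} {j} {r} {i} j≤ℓ r<k not-seam with r′ ≟ r
    ... | yes refl rewrite ≡ᵇ-true {r′} refl = refl
    ... | no r′≢r rewrite ≡ᵇ-false r′≢r with suc r′ ≟ r
    ...   | no 1+r′≢r rewrite ≡ᵇ-false 1+r′≢r | ≡ᵇ-false {j} {suc (ℓ r′)} (λ { refl → <-irrefl refl j≤ℓ }) = refl
    ...   | yes refl rewrite ≡ᵇ-true {suc r′} refl with i ≟ 1
    ...     | yes refl rewrite ≡ᵇ-false {j} {ℓ r′} (λ j≡ℓ → not-seam (j≡ℓ , r<k)) = refl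
    ...     | no i≢1 rewrite ≡ᵇ-false i≢1 | ≡ᵇ-false {j} {suc (ℓ r′)} (λ { refl → <-irrefl refl j≤ℓ }) = refl

  canonical-== : ∀ {r′ j r i} → r′ < k → j ≤ ℓ r′ → Valid (r , i) → (canonical r′ j ==ᵖ (r , i)) ≡ (j ≡ᵇ indexIn r′ (r , i))
  canonical-== {r′} {j} {r} {i} r′<k j≤ℓ (r<k , i≤ , not-seam) with j ≟ ℓ r′ | suc r′ <? k
  ... | yes refl | yes 1+r′<k rewrite canonical-seam 1+r′<k with r′ ≟ r
  ...   | yes refl rewrite ≡ᵇ-false (1+n≢n {r′}) | ≡ᵇ-true {r′} refl | ≡ᵇ-false {ℓ r′} {i} (λ ℓ≡i → not-seam (sym ℓ≡i , 1+r′<k)) = refl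
  ...   | no r′≢r rewrite ≡ᵇ-false r′≢r with suc r′ ≟ r
  ...     | no 1+r′≢r rewrite ≡ᵇ-false 1+r′≢r | ≡ᵇ-false {ℓ r′} {suc (ℓ r′)} (n≢1+n _) = refl
  ...     | yes refl rewrite ≡ᵇ-true {suc r′} refl with i ≟ 1
  ...       | yes refl rewrite ≡ᵇ-true {ℓ r′} refl = refl
  ...       | no i≢1 rewrite ≡ᵇ-false {1} {i} (i≢1 ∘ sym) | ≡ᵇ-false i≢1 | ≡ᵇ-false {ℓ r′} {suc (ℓ r′)} (n≢1+n _) = refl
  canonical-== {r′} {j} _ j≤ℓ (r<k , _) | yes _ | no 1+r′≮k rewrite canonical-other {r′} {j} (1+r′≮k ∘ proj₂) =
    ==ᵖ-indexIn j≤ℓ r<k (1+r′≮k ∘ proj₂)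
  canonical-== {r′} {j} _ j≤ℓ (r<k , _) | no j≢ℓ | _ rewrite canonical-other {r′} {j} (j≢ℓ ∘ proj₁) =
    ==ᵖ-indexIn j≤ℓ r<k (j≢ℓ ∘ proj₁)

  -- the arc from the seam (r − 1 , ℓ (r − 1)) = (r , 1) to the sink of row r − 1
  crossOut : (Vertex → ℕ) → ℕ → ℕ → ℕ
  crossOut F zero i = 0
  crossOut F (suc r) i = if i ≡ᵇ 1 then F (canonical r (suc (ℓ r))) else 0

  outSum-fanOut : ∀ F r i → Valid (r , i) → outSum F (r , i) ≡ fanOut (ℓ r) i (F ∘ canonical r) + crossOut F r i
  outSum-fanOut F r i va@(r<k , i≤ , _) = begin
    outSum F (r , i)
      ≡⟨ trans (sum-map-concat out (applyUpTo (λ r′ → concat (Fan.fanArcs (canonical r′) (ℓ r′))) k))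
               (cong sum (map-applyUpTo _ (sum ∘ map out) k)) ⟩
    sum (applyUpTo (λ r′ → sum (map out (concat (Fan.fanArcs (canonical r′) (ℓ r′))))) k)
      ≡⟨ sum-applyUpTo-cong k (λ r′ r′<k → trans (sum-map-concat out (Fan.fanArcs (canonical r′) (ℓ r′)))
           (Fan.sum-fanArcs (canonical r′) (ℓ r′) (indexIn r′ (r , i)) (F ∘ canonical r′) out (ℓ≥2 r′<k) (indexIn≤ r′)
             (λ j j′ j≤ℓ → cong (λ b → if b then F (canonical r′ j′) else 0) (canonical-== r′<k j≤ℓ va)))) ⟩
    sum (applyUpTo (λ r′ → fanOut (ℓ r′) (indexIn r′ (r , i)) (F ∘ canonical r′)) k)
      ≡⟨ sum-applyUpTo-cong k (λ r′ _ → split r′) ⟩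
    sum (applyUpTo (λ r′ → own r′ + cross r′) k)
      ≡⟨ sum-applyUpTo-+ own cross k ⟩
    sum (applyUpTo own k) + sum (applyUpTo cross k)
      ≡⟨ cong₂ _+_ (sum-applyUpTo-indicator (λ _ → fanOut (ℓ r) i (F ∘ canonical r)) k r r<k) (cross-sum r r<k) ⟩
    fanOut (ℓ r) i (F ∘ canonical r) + crossOut F r i ∎
    where
    open ≡-Reasoning
    out : Vertex × Vertex → ℕ
    out e = if proj₁ e ==ᵖ (r , i) then F (proj₂ e) else 0
    indexIn≤ : ∀ r′ → indexIn r′ (r , i) ≤ suc (ℓ r′)
    indexIn≤ r′ with r′ ≟ r
    ... | yes refl rewrite ≡ᵇ-true {r′} refl = i≤
    ... | no r′≢r rewrite ≡ᵇ-false r′≢r with (suc r′ ≡ᵇ r) ∧ (i ≡ᵇ 1)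
    ...   | true = n≤1+n _
    ...   | false = ≤-refl
    own cross : ℕ → ℕ
    own r′ = if r′ ≡ᵇ r then fanOut (ℓ r) i (F ∘ canonical r) else 0
    cross r′ = if suc r′ ≡ᵇ r then (if i ≡ᵇ 1 then F (canonical r′ (suc (ℓ r′))) else 0) else 0
    split : ∀ r′ → fanOut (ℓ r′) (indexIn r′ (r , i)) (F ∘ canonical r′) ≡ own r′ + cross r′
    split r′ with r′ ≟ r
    ... | yes refl rewrite ≡ᵇ-true {r′} refl | ≡ᵇ-false (1+n≢n {r′}) = sym (+-identityʳ _)
    ... | no r′≢r rewrite ≡ᵇ-false r′≢r with suc r′ ≟ r
    ...   | no 1+r′≢r rewrite ≡ᵇ-false 1+r′≢r = fanOut-beyond (ℓ r′) (F ∘ canonical r′)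
    ...   | yes refl rewrite ≡ᵇ-true {suc r′} refl with i ≟ 1
    ...     | yes refl = fanOut-last (ℓ r′) (F ∘ canonical r′)
    ...     | no i≢1 rewrite ≡ᵇ-false i≢1 = fanOut-beyond (ℓ r′) (F ∘ canonical r′)
    cross-sum : ∀ r → r < k → sum (applyUpTo (λ r′ → if suc r′ ≡ᵇ r then (if i ≡ᵇ 1 then F (canonical r′ (suc (ℓ r′))) else 0) else 0) k) ≡ crossOut F r i
    cross-sum zero _ = sum-applyUpTo-zero _ k (λ _ _ → refl)
    cross-sum (suc q) 1+q<k = sum-applyUpTo-indicator (λ r′ → if i ≡ᵇ 1 then F (canonical r′ (suc (ℓ r′))) else 0) k q (≤-trans (n≤1+n _) 1+q<k)

  -- Path counts

  between : ℕ → ℕ → ℕ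
  between r j = product (applyUpTo (λ s → fib (ℓ (suc r + s))) (j ∸ suc r))

  between-adjacent : ∀ r → between r (suc r) ≡ 1
  between-adjacent r rewrite n∸n≡0 r = refl

  between-suc : ∀ r j → suc r < j → between r j ≡ fib (ℓ (suc r)) * between (suc r) j
  between-suc r j 1+r<j with m≤n⇒∃[o]m+o≡n 1+r<j
  ... | o , refl = begin
    product (applyUpTo (λ s → fib (ℓ (suc r + s))) (2 + r + o ∸ suc r))
      ≡⟨ cong (λ n → product (applyUpTo (λ s → fib (ℓ (suc r + s))) n))
           (trans (cong (_∸ suc r) (sym (+-suc (suc r) o))) (m+n∸m≡n (suc r) (suc o))) ⟩
    product (applyUpTo (λ s → fib (ℓ (suc r + s))) (suc o))
      ≡⟨ cong₂ _*_ (cong (fib ∘ ℓ) (+-identityʳ (suc r))) (cong product (applyUpTo-cong o (λ s _ → cong (fib ∘ ℓ) (+-suc (suc r) s)))) ⟩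
    fib (ℓ (suc r)) * product (applyUpTo (λ s → fib (ℓ (2 + r + s))) o)
      ≡⟨ cong (λ n → fib (ℓ (suc r)) * product (applyUpTo (λ s → fib (ℓ (2 + r + s))) n)) (m+n∸m≡n (suc (suc r)) o) ⟨
    fib (ℓ (suc r)) * between (suc r) (2 + r + o) ∎
    where open ≡-Reasoning

  private
    1+n∸n≡1 : ∀ n → suc n ∸ n ≡ 1
    1+n∸n≡1 n = m+n∸n≡m 1 n

    2+n∸n≡2 : ∀ n → suc (suc n) ∸ n ≡ 2
    2+n∸n≡2 n = m+n∸n≡m 2 n

    1+m+n∸m≡1+n : ∀ m n → suc (m + n) ∸ m ≡ suc n
    1+m+n∸m≡1+n m n = trans (cong (_∸ m) (sym (+-suc m n))) (m+n∸m≡n m (suc n))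

    2+m+n∸m≡2+n : ∀ m n → suc (suc (m + n)) ∸ m ≡ suc (suc n)
    2+m+n∸m≡2+n m n = trans (cong (λ x → suc x ∸ m) (sym (+-suc m n))) (1+m+n∸m≡1+n m (suc n))

  fib-recurrence-∸ : ∀ L i → i < L → fib (suc L ∸ suc i) + fib (suc L ∸ suc (suc i)) ≡ fib (suc L ∸ i)
  fib-recurrence-∸ L i i<L with m≤n⇒∃[o]m+o≡n i<L
  ... | o , refl rewrite 1+m+n∸m≡1+n i o | m+n∸m≡n i o | 2+m+n∸m≡2+n i o = refl

  -- the number of paths from (r , i) to the sink (j , ℓ j + 1) of row j: a path from row r < j
  -- runs through the seams of rows r, …, j − 1, and within one fan path counts are Fibonacci numbers
  module PathsToSink (j : ℕ) (j<k : j < k) where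

    sink : Vertex
    sink = (j , suc (ℓ j))

    -- the number of paths from (r + 1 , 1) to the sink, for r < j
    beyond : ℕ → ℕ
    beyond r = between r j * fib (suc (ℓ j))

    Φ : Vertex → ℕ
    Φ (r , i) = if r <ᵇ j then fib (suc (ℓ r) ∸ i) * beyond r
                else (if r ≡ᵇ j then fib (suc (suc (ℓ j)) ∸ i)
                else (if r ≡ᵇ suc j then (if i ≤ᵇ 1 then 1 else 0) else 0))

    Φ-before : ∀ {r} m → r < j → Φ (r , m) ≡ fib (suc (ℓ r) ∸ m) * beyond r
    Φ-before m r<j rewrite <ᵇ-true r<j = refl

    Φ-at : ∀ m → Φ (j , m) ≡ fib (suc (suc (ℓ j)) ∸ m)
    Φ-at m rewrite <ᵇ-false {j} {j} (<-irrefl refl) | ≡ᵇ-true {j} refl = refl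

    Φ-next : ∀ m → Φ (suc j , m) ≡ (if m ≤ᵇ 1 then 1 else 0)
    Φ-next m rewrite <ᵇ-false {suc j} {j} (λ 1+j<j → <-irrefl refl (≤-trans (n≤1+n _) 1+j<j))
                   | ≡ᵇ-false {suc j} {j} 1+n≢n | ≡ᵇ-true {j} refl = refl

    Φ-after : ∀ {r} m → suc j < r → Φ (r , m) ≡ 0
    Φ-after {r} m 1+j<r rewrite <ᵇ-false {r} {j} (λ r<j → <-asym r<j (≤-trans (n≤1+n _) 1+j<r))
                              | ≡ᵇ-false {r} {j} (λ r≡j → <-irrefl (sym r≡j) (≤-trans (n≤1+n _) 1+j<r))
                              | ≡ᵇ-false {r} {suc j} (λ r≡1+j → <-irrefl (sym r≡1+j) 1+j<r) = refl

    Φ-sink : Φ sink ≡ 1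
    Φ-sink = trans (Φ-at (suc (ℓ j))) (cong fib (1+n∸n≡1 (suc (ℓ j))))

    beyond-suc : ∀ r → suc r < j → beyond r ≡ fib (ℓ (suc r)) * beyond (suc r)
    beyond-suc r 1+r<j = trans (cong (_* fib (suc (ℓ j))) (between-suc r j 1+r<j)) (*-assoc (fib (ℓ (suc r))) _ _)

    beyond-last : ∀ r → suc r ≡ j → beyond r ≡ fib (suc (ℓ j))
    beyond-last r refl = trans (cong (_* fib (suc (ℓ (suc r)))) (between-adjacent r)) (+-identityʳ _)

    Φ-canonical-before : ∀ {r m} → r < j → m ≤ suc (ℓ r) → Φ (canonical r m) ≡ fib (suc (ℓ r) ∸ m) * beyond r
    Φ-canonical-before {r} {m} r<j m≤ with m ≟ ℓ r
    ... | no m≢ℓ rewrite canonical-other {r} {m} (m≢ℓ ∘ proj₁) = Φ-before m r<j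
    ... | yes refl rewrite canonical-seam (≤-trans (s≤s r<j) j<k) | 1+n∸n≡1 (ℓ r) | +-identityʳ (beyond r) with suc r <? j
    ...   | yes 1+r<j = trans (Φ-before 1 1+r<j) (sym (beyond-suc r 1+r<j))
    ...   | no 1+r≮j = trans (cong (λ q → Φ (q , 1)) 1+r≡j) (trans (Φ-at 1) (sym (beyond-last r 1+r≡j)))
      where
      1+r≡j : suc r ≡ j
      1+r≡j = ≤-antisym r<j (≮⇒≥ 1+r≮j)

    Φ-canonical-at : ∀ {m} → m ≤ suc (ℓ j) → Φ (canonical j m) ≡ fib (suc (suc (ℓ j)) ∸ m)
    Φ-canonical-at {m} _ with m ≟ ℓ j | suc j <? k
    ... | yes refl | yes 1+j<k rewrite canonical-seam 1+j<k | 2+n∸n≡2 (ℓ j) = Φ-next 1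
    ... | yes _ | no 1+j≮k rewrite canonical-other {j} {m} (1+j≮k ∘ proj₂) = Φ-at m
    ... | no m≢ℓ | _ rewrite canonical-other {j} {m} (m≢ℓ ∘ proj₁) = Φ-at m

    Φ-canonical-next : ∀ {m} → suc j < k → Φ (canonical (suc j) m) ≡ (if m ≤ᵇ 1 then 1 else 0)
    Φ-canonical-next {m} 1+j<k with m ≟ ℓ (suc j) | suc (suc j) <? k
    ... | yes refl | yes 2+j<k rewrite canonical-seam 2+j<k
                                     | ≤ᵇ-false {ℓ (suc j)} {1} (λ ℓ≤1 → <-irrefl refl (≤-trans (ℓ≥2 1+j<k) ℓ≤1)) = Φ-after 1 ≤-refl
    ... | yes _ | no 2+j≮k rewrite canonical-other {suc j} {m} (2+j≮k ∘ proj₂) = Φ-next m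
    ... | no m≢ℓ | _ rewrite canonical-other {suc j} {m} (m≢ℓ ∘ proj₁) = Φ-next m

    Φ-canonical-after : ∀ {r m} → suc j < r → Φ (canonical r m) ≡ 0
    Φ-canonical-after {r} {m} 1+j<r with m ≟ ℓ r | suc r <? k
    ... | yes refl | yes 1+r<k rewrite canonical-seam 1+r<k = Φ-after 1 (≤-trans 1+j<r (n≤1+n _))
    ... | yes _ | no 1+r≮k rewrite canonical-other {r} {m} (1+r≮k ∘ proj₂) = Φ-after m 1+j<r
    ... | no m≢ℓ | _ rewrite canonical-other {r} {m} (m≢ℓ ∘ proj₁) = Φ-after m 1+j<r

    private
      if-0 : ∀ b → (if b then 0 else 0) ≡ 0
      if-0 true = refl
      if-0 false = refl

    crossOut-before : ∀ r i → r ≤ j → crossOut Φ r i ≡ 0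
    crossOut-before zero i _ = refl
    crossOut-before (suc r) i r<j rewrite canonical-other {r} {suc (ℓ r)} (n≢1+n _ ∘ sym ∘ proj₁)
                                        | Φ-before (suc (ℓ r)) r<j | n∸n≡0 (suc (ℓ r)) = if-0 (i ≡ᵇ 1)

    crossOut-next : ∀ i → crossOut Φ (suc j) i ≡ (if i ≡ᵇ 1 then 1 else 0)
    crossOut-next i rewrite canonical-other {j} {suc (ℓ j)} (n≢1+n _ ∘ sym ∘ proj₁) | Φ-at (suc (ℓ j)) | 1+n∸n≡1 (suc (ℓ j)) = refl

    crossOut-after : ∀ r i → r < k → suc j < r → crossOut Φ r i ≡ 0
    crossOut-after (suc r) i 1+r<k (s≤s j<r) with suc j ≟ r
    ... | yes refl rewrite canonical-other {suc j} {suc (ℓ (suc j))} (n≢1+n _ ∘ sym ∘ proj₁) | Φ-next (suc (ℓ (suc j)))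
                         | ≤ᵇ-false {suc (ℓ (suc j))} {1} (λ 2+ℓ≤1 → <-irrefl refl (≤-trans (s≤s (≤-trans (s≤s z≤n) (ℓ≥2 (≤-trans (n≤1+n _) 1+r<k)))) 2+ℓ≤1)) =
      if-0 (i ≡ᵇ 1)
    ... | no 1+j≢r rewrite Φ-canonical-after {r} {suc (ℓ r)} (≤∧≢⇒< j<r 1+j≢r) = if-0 (i ≡ᵇ 1)

    Φ-out-before : ∀ r i → Valid (r , i) → r < j → fanOut (ℓ r) i (Φ ∘ canonical r) ≡ Φ (r , i)
    Φ-out-before r i (r<k , i≤ , not-seam) r<j with <-cmp i (ℓ r)
    ... | tri< i<ℓ _ _ rewrite <ᵇ-true i<ℓ | Φ-canonical-before {r} {suc i} r<j (s≤s (<⇒≤ i<ℓ))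
                             | Φ-canonical-before {r} {suc (suc i)} r<j (s≤s i<ℓ) | Φ-before i r<j =
      trans (sym (*-distribʳ-+ (beyond r) (fib (suc (ℓ r) ∸ suc i)) _)) (cong (_* beyond r) (fib-recurrence-∸ (ℓ r) i i<ℓ))
    ... | tri≈ _ i≡ℓ _ = ⊥-elim (not-seam (i≡ℓ , ≤-trans (s≤s r<j) j<k))
    ... | tri> _ _ ℓ<i with ≤-antisym i≤ ℓ<i
    ...   | refl rewrite fanOut-beyond (ℓ r) (Φ ∘ canonical r) | Φ-before (suc (ℓ r)) r<j | n∸n≡0 (suc (ℓ r)) = refl

    Φ-out-at : ∀ i → Valid (j , i) → ((j , i) ==ᵖ sink) ≡ false → fanOut (ℓ j) i (Φ ∘ canonical j) ≡ Φ (j , i)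
    Φ-out-at i (_ , i≤ , _) not-sink with <-cmp i (ℓ j)
    ... | tri< i<ℓ _ _ rewrite <ᵇ-true i<ℓ | Φ-canonical-at {suc i} (s≤s (<⇒≤ i<ℓ)) | Φ-canonical-at {suc (suc i)} (s≤s i<ℓ) | Φ-at i =
      fib-recurrence-∸ (suc (ℓ j)) i (≤-trans i<ℓ (n≤1+n _))
    ... | tri≈ _ refl _ rewrite fanOut-last (ℓ j) (Φ ∘ canonical j) | Φ-canonical-at {suc (ℓ j)} ≤-refl | Φ-at (ℓ j)
                              | 1+n∸n≡1 (suc (ℓ j)) | 2+n∸n≡2 (ℓ j) = refl
    ... | tri> _ _ ℓ<i with ≤-antisym i≤ ℓ<i
    ...   | refl with trans (sym not-sink) (==ᵖ-refl sink)
    ...     | ()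

    Φ-out-next : ∀ i → suc j < k → fanOut (ℓ (suc j)) i (Φ ∘ canonical (suc j)) + crossOut Φ (suc j) i ≡ Φ (suc j , i)
    Φ-out-next zero 1+j<k rewrite crossOut-next 0 | <ᵇ-true {0} {ℓ (suc j)} (≤-trans (s≤s z≤n) (ℓ≥2 1+j<k))
                                | Φ-canonical-next {1} 1+j<k | Φ-canonical-next {2} 1+j<k | Φ-next 0 = refl
    Φ-out-next (suc zero) 1+j<k rewrite crossOut-next 1 | <ᵇ-true {1} {ℓ (suc j)} (ℓ≥2 1+j<k)
                                      | Φ-canonical-next {2} 1+j<k | Φ-canonical-next {3} 1+j<k | Φ-next 1 = refl
    Φ-out-next (suc (suc i)) 1+j<k rewrite crossOut-next (suc (suc i)) | Φ-next (suc (suc i)) =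
      trans (+-identityʳ _) (fanOut-zero (ℓ (suc j)) (suc (suc i)) (Φ ∘ canonical (suc j))
        (λ m 3+i≤m → trans (Φ-canonical-next {m} 1+j<k) (cong (λ b → if b then 1 else 0) (≤ᵇ-false (λ m≤1 → 3+i≰1 (≤-trans 3+i≤m m≤1))))))
      where
      3+i≰1 : ¬ (3 + i ≤ 1)
      3+i≰1 (s≤s ())

    Φ-out : ∀ a → Valid a → (a ==ᵖ sink) ≡ false → outSum Φ a ≡ Φ a
    Φ-out (r , i) va@(r<k , _) not-sink with <-cmp r j
    ... | tri< r<j _ _ = trans (outSum-fanOut Φ r i va)
      (trans (cong (fanOut (ℓ r) i (Φ ∘ canonical r) +_) (crossOut-before r i (<⇒≤ r<j)))
             (trans (+-identityʳ _) (Φ-out-before r i va r<j)))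
    ... | tri≈ _ refl _ = trans (outSum-fanOut Φ r i va)
      (trans (cong (fanOut (ℓ r) i (Φ ∘ canonical r) +_) (crossOut-before r i ≤-refl))
             (trans (+-identityʳ _) (Φ-out-at i va not-sink)))
    ... | tri> _ _ j<r with suc j ≟ r
    ...   | yes refl = trans (outSum-fanOut Φ r i va) (Φ-out-next i r<k)
    ...   | no 1+j≢r rewrite Φ-after {r} i (≤∧≢⇒< j<r 1+j≢r) = trans (outSum-fanOut Φ r i va)
      (trans (cong₂ _+_ (fanOut-zero (ℓ r) i (Φ ∘ canonical r) (λ m _ → Φ-canonical-after {r} {m} (≤∧≢⇒< j<r 1+j≢r)))
                        (crossOut-after r i r<k (≤∧≢⇒< j<r 1+j≢r))) refl)

  arrows-embedded : arrows conv tiles ≡ embeddedArcs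
  arrows-embedded = trans arrows-nodeArcs (sym embed-arcs)

  any-heads : ∀ a → Valid a → any (λ e → proj₂ e ==ᵖ nodeAt a) embeddedArcs ≡ any (λ e → proj₂ e ==ᵖ a) arcs
  any-heads a va = trans (any-map _ embedArc arcs)
    (any-cong arcs (λ e e∈ → embed-== (proj₂ e) a (proj₁ (proj₂ (All.lookup arcs-ok e∈))) va))

  any-tails : ∀ a → Valid a → any (λ e → proj₁ e ==ᵖ nodeAt a) embeddedArcs ≡ any (λ e → proj₁ e ==ᵖ a) arcs
  any-tails a va = trans (any-map _ embedArc arcs)
    (any-cong arcs (λ e e∈ → embed-== (proj₁ e) a (proj₁ (All.lookup arcs-ok e∈)) va))

  valid-source : ∀ {r} → r < k → Valid (r , 0)
  valid-source r<k = r<k , z≤n , ℓ≢0 r<k ∘ proj₁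

  valid-sink : ∀ {r} → r < k → Valid (r , suc (ℓ r))
  valid-sink r<k = r<k , ≤-refl , n≢1+n _ ∘ sym ∘ proj₁

  isSource-node : ∀ {r m} → r < k → m ≤ suc (ℓ r) → isSource embeddedArcs (node r m) ≡ (m ≡ᵇ 0)
  isSource-node {r} {zero} r<k _ =
    trans (cong (isSource embeddedArcs) (trans (sym (nodeAt-canonical 0 r<k)) (cong nodeAt (canonical-other {r} {0} (ℓ≢0 r<k ∘ proj₁)))))
      (trans (cong not (any-heads (r , 0) (valid-source r<k)))
        (cong not (any-false _ arcs (All-arcs (λ r′ j j′ _ j<j′ _ _ → index≥1 (canonical r′ j′) (canonical-index≥1 r′ j′ (≤-trans (s≤s z≤n) j<j′)))))))
    where
    index≥1 : ∀ (b : Vertex) → 1 ≤ proj₂ b → (b ==ᵖ (r , 0)) ≡ false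
    index≥1 (r′ , suc j) _ with r′ ≡ᵇ r
    ... | true = refl
    ... | false = refl
  isSource-node {r} {suc m} r<k 1+m≤ =
    trans (cong (isSource embeddedArcs) (sym (nodeAt-canonical (suc m) r<k)))
      (trans (cong not (any-heads (canonical r (suc m)) (canonical-valid r<k 1+m≤)))
        (cong not (any-true _ arcs (∈-arcs r<k (≤-pred 1+m≤)) (==ᵖ-refl (canonical r (suc m))))))

  isSink-node : ∀ {r m} → r < k → m ≤ suc (ℓ r) → isSink embeddedArcs (node r m) ≡ (m ≡ᵇ suc (ℓ r))
  isSink-node {r} {m} r<k m≤ with m ≟ suc (ℓ r)
  ... | yes refl =
    trans (cong (isSink embeddedArcs) (trans (sym (nodeAt-canonical (suc (ℓ r)) r<k)) (cong nodeAt (canonical-other {r} {suc (ℓ r)} (n≢1+n _ ∘ sym ∘ proj₁)))))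
      (trans (cong not (any-tails (r , suc (ℓ r)) (valid-sink r<k)))
        (trans (cong not (any-false _ arcs (All-arcs (λ r′ j _ r′<k _ _ j≤ℓ →
          trans (canonical-== r′<k j≤ℓ (valid-sink r<k)) (≡ᵇ-false {j} (λ j≡ → <-irrefl refl (≤-trans (≤-reflexive (sym (trans j≡ (indexIn-sink r′)))) j≤ℓ)))))))
        (sym (≡ᵇ-true {ℓ r} refl))))
    where
    indexIn-sink : ∀ r′ → indexIn r′ (r , suc (ℓ r)) ≡ suc (ℓ r′)
    indexIn-sink r′ with r′ ≟ r
    ... | yes refl rewrite ≡ᵇ-true {r′} refl = refl
    ... | no r′≢r rewrite ≡ᵇ-false r′≢r | ≡ᵇ-false {ℓ r} {0} (ℓ≢0 r<k ∘ sym) with suc r′ ≡ᵇ r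
    ...   | true = refl
    ...   | false = refl
  ... | no m≢ = trans (cong (isSink embeddedArcs) (sym (nodeAt-canonical m r<k)))
    (trans (cong not (any-tails (canonical r m) (canonical-valid r<k m≤)))
      (trans (cong not (any-true _ arcs (∈-arcs r<k (≤-pred (≤∧≢⇒< m≤ m≢))) (==ᵖ-refl (canonical r m)))) (sym (≡ᵇ-false m≢))))

  -- Vertices

  -- the fan positions of the corners (south-west, south-east, north-west, north-east) of tile (r , t)
  cornerIndices : ℕ → ℕ → List ℕ
  cornerIndices r t = if north r t then t ∷ suc (suc t) ∷ suc t ∷ suc t ∷ [] else suc t ∷ suc t ∷ t ∷ suc (suc t) ∷ []

  corners-tile : ∀ r t → corners (X r + t , r) ≡
    (if north r t then (X r + t , freeY r t) ∷ (suc (X r + t) , freeY r t) ∷ (X r + t , contractedY r t) ∷ (suc (X r + t) , contractedY r t) ∷ []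
     else (X r + t , contractedY r t) ∷ (suc (X r + t) , contractedY r t) ∷ (X r + t , freeY r t) ∷ (suc (X r + t) , freeY r t) ∷ [])
  corners-tile r t with north r t
  ... | true = refl
  ... | false = refl

  private
    map-if : ∀ {A B : Set} (f : A → B) b xs ys → map f (if b then xs else ys) ≡ (if b then map f xs else map f ys)
    map-if f true xs ys = refl
    map-if f false xs ys = refl

  corners-nodes : ∀ {r t} → r < k → t < ℓ r → map repr (corners (X r + t , r)) ≡ map (node r) (cornerIndices r t)
  corners-nodes {r} {t} r<k t<ℓ = begin
    map repr (corners (X r + t , r))
      ≡⟨ trans (cong (map repr) (corners-tile r t)) (map-if repr (north r t) _ _) ⟩
    (if north r t then _ else _)
      ≡⟨ cong₂ (if_then_else_ (north r t))
           (cong₂ _∷_ fw (cong₂ _∷_ fe (cong₂ _∷_ cw (cong₂ _∷_ ce refl))))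
           (cong₂ _∷_ cw (cong₂ _∷_ ce (cong₂ _∷_ fw (cong₂ _∷_ fe refl)))) ⟩
    (if north r t then _ else _)
      ≡⟨ map-if (node r) (north r t) _ _ ⟨
    map (node r) (cornerIndices r t) ∎
    where
    open ≡-Reasoning
    fw : repr (X r + t , freeY r t) ≡ node r t
    fw = repr-free-w r<k t<ℓ
    fe : repr (suc (X r + t) , freeY r t) ≡ node r (suc (suc t))
    fe = repr-free-e r<k t<ℓ
    cw : repr (X r + t , contractedY r t) ≡ node r (suc t)
    cw = repr-contracted-w r<k t<ℓ
    ce : repr (suc (X r + t) , contractedY r t) ≡ node r (suc t)
    ce = repr-contracted-e r<k t<ℓ

  cornerIndices-bounded : ∀ {r t} → t < ℓ r → All (_≤ suc (ℓ r)) (cornerIndices r t)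
  cornerIndices-bounded {r} {t} t<ℓ with north r t
  ... | true = ≤-trans (n≤1+n _) t≤ ∷ s≤s t<ℓ ∷ t≤ ∷ t≤ ∷ []
    where
    t≤ : suc t ≤ suc (ℓ r)
    t≤ = ≤-trans t<ℓ (n≤1+n _)
  ... | false = t≤ ∷ t≤ ∷ ≤-trans (n≤1+n _) t≤ ∷ s≤s t<ℓ ∷ []
    where
    t≤ : suc t ≤ suc (ℓ r)
    t≤ = ≤-trans t<ℓ (n≤1+n _)

  1+t∈cornerIndices : ∀ r t → suc t ∈ cornerIndices r t
  1+t∈cornerIndices r t with north r t
  ... | true = there (there (here refl))
  ... | false = here refl

  2+t∈cornerIndices : ∀ r t → suc (suc t) ∈ cornerIndices r t
  2+t∈cornerIndices r t with north r t
  ... | true = there (here refl)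
  ... | false = there (there (there (here refl)))

  cornerReps : List Point
  cornerReps = map repr (concatMap corners tiles)

  cornerReps-perTile : cornerReps ≡ concat (perTile (λ r t → map (node r) (cornerIndices r t)))
  cornerReps-perTile = trans (sym (concat-map (map corners tiles)))
    (cong concat (trans (cong (map (map repr)) (map-perTile corners (λ r t → (X r + t , r))))
                 (trans (map-perTile (map repr) (λ r t → corners (X r + t , r))) (perTile-cong (λ r t r<k t<ℓ → corners-nodes r<k t<ℓ)))))

  node∈vertices : ∀ {r t i} → r < k → t < ℓ r → i ∈ cornerIndices r t → node r i ∈ vertices conv tiles
  node∈vertices {r} {t} {i} r<k t<ℓ i∈ = Dedup.∈-deduplicateᵇ _==ᵖ_ ==ᵖ-sound cornerReps
    (subst (node r i ∈_) (sym cornerReps-perTile) (∈-concat⁺′ (∈-map⁺ (node r) i∈) (∈-perTile (λ r t → map (node r) (cornerIndices r t)) r t r<k t<ℓ)))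

  -- the columns 0, …, X k + 1 all carry vertices
  length-vertices : top ≤ length (vertices conv tiles)
  length-vertices = length-≥-keys proj₁ (vertices conv tiles) top column
    where
    column : ∀ x → x < top → ∃[ v ] (v ∈ vertices conv tiles × proj₁ v ≡ x)
    column x x<top with x ≤? X k
    ... | yes x≤ with column-decomp x x≤
    ...   | r , t , r<k , t<ℓ , x≡ = node r (suc t) , node∈vertices r<k t<ℓ (1+t∈cornerIndices r t) , x≡
    column x x<top | no x≰ = node r (suc (suc t)) , node∈vertices r<k t<ℓ (2+t∈cornerIndices r t) , x≡
      where
      r t : ℕ
      r = k ∸ 1
      t = suc (ℓ₂ r)
      r<k : r < k
      r<k = ≤-reflexive (sym k≡1+k∸1)
      t<ℓ : t < ℓ r
      t<ℓ = ≤-reflexive (sym (ℓ≡2+ℓ₂ r<k))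
      x≡ : X r + suc t ≡ x
      x≡ = trans (+-suc (X r) t) (trans (cong suc (sym (X-suc r<k))) (trans (cong (suc ∘ X) (sym k≡1+k∸1))
             (≤-antisym (≰⇒> x≰) (≤-pred (≤-trans x<top (≤-reflexive (+-comm (X k) 2)))))))

  -- Sources and sinks

  selected-vertices : ∀ (p : Point → Bool) (f : ℕ → Point) →
    concat (perTile (λ r t → filterᵇ p (map (node r) (cornerIndices r t)))) ≡ applyUpTo f k → IncreasingY f k →
    sortY (filter (λ v → p v ≟ᴮ true) (vertices conv tiles)) ≡ applyUpTo f k
  selected-vertices p f per-tile increasing = begin
    sortY (filter (λ v → p v ≟ᴮ true) (deduplicateᵇ _==ᵖ_ cornerReps))
      ≡⟨ cong sortY (filter-does (λ v → p v ≟ᴮ true) p (does-≟true ∘ p) (deduplicateᵇ _==ᵖ_ cornerReps)) ⟩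
    sortY (filterᵇ p (deduplicateᵇ _==ᵖ_ cornerReps))
      ≡⟨ cong sortY (Dedup.filterᵇ-deduplicateᵇ _==ᵖ_ p (λ a b a≡b → cong p (==ᵖ-sound a b a≡b)) cornerReps) ⟩
    sortY (deduplicateᵇ _==ᵖ_ (filterᵇ p cornerReps))
      ≡⟨ cong (λ vs → sortY (deduplicateᵇ _==ᵖ_ (filterᵇ p vs))) cornerReps-perTile ⟩
    sortY (deduplicateᵇ _==ᵖ_ (filterᵇ p (concat (perTile (λ r t → map (node r) (cornerIndices r t))))))
      ≡⟨ cong (λ vs → sortY (deduplicateᵇ _==ᵖ_ vs))
           (trans (filterᵇ-concat p (perTile (λ r t → map (node r) (cornerIndices r t))))
                  (trans (cong concat (map-perTile (filterᵇ p) (λ r t → map (node r) (cornerIndices r t)))) per-tile)) ⟩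
    sortY (deduplicateᵇ _==ᵖ_ (applyUpTo f k))
      ≡⟨ cong sortY (Dedup.deduplicateᵇ-unrelated _==ᵖ_ _ (unrelated-increasingY f k increasing)) ⟩
    sortY (applyUpTo f k)
      ≡⟨ sortY-increasingY f k increasing ⟩
    applyUpTo f k ∎
    where
    open ≡-Reasoning
    does-≟true : ∀ b → does (b ≟ᴮ true) ≡ b
    does-≟true true = refl
    does-≟true false = refl

  filterᵇ-corners : ∀ {r t} (p : Point → Bool) (q : ℕ → Bool) → t < ℓ r → (∀ i → i ≤ suc (ℓ r) → p (node r i) ≡ q i) →
    filterᵇ p (map (node r) (cornerIndices r t)) ≡ map (node r) (filterᵇ q (cornerIndices r t))
  filterᵇ-corners {r} {t} p q t<ℓ p≡q = trans (filterᵇ-map p (node r) (cornerIndices r t))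
    (cong (map (node r)) (filterᵇ-cong (cornerIndices r t) (λ i i∈ → p≡q i (All.lookup (cornerIndices-bounded t<ℓ) i∈))))

  concat-perTile : ∀ {A : Set} (g : ℕ → ℕ → List A) → concat (perTile g) ≡ concat (applyUpTo (λ r → concat (applyUpTo (g r) (ℓ r))) k)
  concat-perTile g = trans (sym (concat-concat (applyUpTo (λ r → applyUpTo (g r) (ℓ r)) k))) (cong concat (map-applyUpTo _ concat k))

  sourceIndices : ∀ r t → filterᵇ (_≡ᵇ 0) (cornerIndices r t) ≡ (if t ≡ᵇ 0 then [ 0 ] else [])
  sourceIndices r zero with north r 0
  ... | true = refl
  ... | false = refl
  sourceIndices r (suc t) with north r (suc t)
  ... | true = refl
  ... | false = refl

  sinkIndices : ∀ {r t} → t < ℓ r → filterᵇ (_≡ᵇ suc (ℓ r)) (cornerIndices r t) ≡ (if suc t ≡ᵇ ℓ r then [ suc (suc t) ] else [])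
  sinkIndices {r} {t} t<ℓ with north r t
  ... | true = trans (filterᵇ-reject q {t} (suc (suc t) ∷ suc t ∷ suc t ∷ []) t-no) (trans (filterᵇ-∷ q (suc (suc t)) (suc t ∷ suc t ∷ []))
    (cong (λ xs → if suc t ≡ᵇ ℓ r then suc (suc t) ∷ xs else xs) (filterᵇ-none q (suc t ∷ suc t ∷ []) (1+t-no ∷ 1+t-no ∷ []))))
    where
    q : ℕ → Bool
    q = _≡ᵇ suc (ℓ r)
    t-no : q t ≡ false
    t-no = ≡ᵇ-false {t} {suc (ℓ r)} (λ { refl → <-irrefl refl (≤-trans t<ℓ (n≤1+n _)) })
    1+t-no : q (suc t) ≡ false
    1+t-no = ≡ᵇ-false {t} (<⇒≢ t<ℓ)
  ... | false = trans (filterᵇ-reject q {suc t} (suc t ∷ t ∷ suc (suc t) ∷ []) 1+t-no)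
    (trans (filterᵇ-reject q {suc t} (t ∷ suc (suc t) ∷ []) 1+t-no)
    (trans (filterᵇ-reject q {t} (suc (suc t) ∷ []) t-no) (filterᵇ-∷ q (suc (suc t)) [])))
    where
    q : ℕ → Bool
    q = _≡ᵇ suc (ℓ r)
    t-no : q t ≡ false
    t-no = ≡ᵇ-false {t} {suc (ℓ r)} (λ { refl → <-irrefl refl (≤-trans t<ℓ (n≤1+n _)) })
    1+t-no : q (suc t) ≡ false
    1+t-no = ≡ᵇ-false {t} (<⇒≢ t<ℓ)

  sources-perTile : concat (perTile (λ r t → filterᵇ (isSource embeddedArcs) (map (node r) (cornerIndices r t)))) ≡ applyUpTo (λ r → node r 0) k
  sources-perTile = begin
    concat (perTile (λ r t → filterᵇ (isSource embeddedArcs) (map (node r) (cornerIndices r t))))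
      ≡⟨ cong concat (perTile-cong (λ r t r<k t<ℓ →
           trans (filterᵇ-corners _ _ t<ℓ (λ i i≤ → isSource-node r<k i≤)) (cong (map (node r)) (sourceIndices r t)))) ⟩
    concat (perTile (λ r t → map (node r) (if t ≡ᵇ 0 then [ 0 ] else [])))
      ≡⟨ concat-perTile _ ⟩
    concat (applyUpTo (λ r → concat (applyUpTo (λ t → map (node r) (if t ≡ᵇ 0 then [ 0 ] else [])) (ℓ r))) k)
      ≡⟨ cong concat (applyUpTo-cong k row) ⟩
    concat (applyUpTo (λ r → [ node r 0 ]) k)
      ≡⟨ concat-applyUpTo-[ (λ r → node r 0) ] k ⟩
    applyUpTo (λ r → node r 0) k ∎
    where
    open ≡-Reasoning
    row : ∀ r → r < k → concat (applyUpTo (λ t → map (node r) (if t ≡ᵇ 0 then [ 0 ] else [])) (ℓ r)) ≡ [ node r 0 ]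
    row r r<k = subst (λ L → concat (applyUpTo (λ t → map (node r) (if t ≡ᵇ 0 then [ 0 ] else [])) L) ≡ [ node r 0 ])
      (sym (ℓ≡1+ℓ∸1 r<k)) (cong (node r 0 ∷_) (concat-applyUpTo-[] _ (ℓ r ∸ 1) (λ _ _ → refl)))

  sinks-perTile : concat (perTile (λ r t → filterᵇ (isSink embeddedArcs) (map (node r) (cornerIndices r t)))) ≡ applyUpTo (λ r → node r (suc (ℓ r))) k
  sinks-perTile = begin
    concat (perTile (λ r t → filterᵇ (isSink embeddedArcs) (map (node r) (cornerIndices r t))))
      ≡⟨ cong concat (perTile-cong (λ r t r<k t<ℓ →
           trans (filterᵇ-corners _ _ t<ℓ (λ i i≤ → isSink-node r<k i≤)) (cong (map (node r)) (sinkIndices t<ℓ)))) ⟩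
    concat (perTile (λ r t → map (node r) (if suc t ≡ᵇ ℓ r then [ suc (suc t) ] else [])))
      ≡⟨ concat-perTile _ ⟩
    concat (applyUpTo (λ r → concat (applyUpTo (λ t → map (node r) (if suc t ≡ᵇ ℓ r then [ suc (suc t) ] else [])) (ℓ r))) k)
      ≡⟨ cong concat (applyUpTo-cong k (λ r r<k → row r (ℓ r) (ℓ≡1+ℓ∸1 r<k))) ⟩
    concat (applyUpTo (λ r → [ node r (suc (ℓ r)) ]) k)
      ≡⟨ concat-applyUpTo-[ (λ r → node r (suc (ℓ r))) ] k ⟩
    applyUpTo (λ r → node r (suc (ℓ r))) k ∎
    where
    open ≡-Reasoning
    row : ∀ r L → L ≡ suc (L ∸ 1) → concat (applyUpTo (λ t → map (node r) (if suc t ≡ᵇ L then [ suc (suc t) ] else [])) L) ≡ [ node r (suc L) ]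
    row r (suc L) _ = begin
      concat (applyUpTo f (suc L))          ≡⟨ cong concat (applyUpTo-∷ʳ f L) ⟨
      concat (applyUpTo f L ++ [ f L ])     ≡⟨ concat-++ (applyUpTo f L) [ f L ] ⟨
      concat (applyUpTo f L) ++ (f L ++ []) ≡⟨ cong₂ _++_ (concat-applyUpTo-[] f L early) (trans (++-identityʳ (f L)) final) ⟩
      [ node r (suc (suc L)) ]              ∎
      where
      f : ℕ → List Point
      f t = map (node r) (if suc t ≡ᵇ suc L then [ suc (suc t) ] else [])
      early : ∀ t → t < L → f t ≡ []
      early t t<L rewrite ≡ᵇ-false (<⇒≢ t<L) = refl
      final : f L ≡ [ node r (suc (suc L)) ]
      final rewrite ≡ᵇ-true {L} refl = refl

  sources-nodes : sources conv tiles ≡ applyUpTo (λ r → node r 0) k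
  sources-nodes = trans (cong (λ as → sortY (filter (λ v → isSource as v ≟ᴮ true) (vertices conv tiles))) arrows-embedded)
    (selected-vertices (isSource embeddedArcs) (λ r → node r 0) sources-perTile increasing)
    where
    increasing : IncreasingY (λ r → node r 0) k
    increasing r 1+r<k rewrite north-first 1+r<k with north r 0
    ... | true = ≤-trans (n≤1+n _) ≤-refl
    ... | false = ≤-refl

  sinks-nodes : sinks conv tiles ≡ applyUpTo (λ r → node r (suc (ℓ r))) k
  sinks-nodes = trans (cong (λ as → sortY (filter (λ v → isSink as v ≟ᴮ true) (vertices conv tiles))) arrows-embedded)
    (selected-vertices (isSink embeddedArcs) (λ r → node r (suc (ℓ r))) sinks-perTile increasing)
    where
    increasing : IncreasingY (λ r → node r (suc (ℓ r))) k
    increasing r 1+r<k rewrite sink-y 1+r<k with node-y (suc r) (suc (ℓ (suc r)))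
    ... | inj₁ y≡ rewrite y≡ = ≤-refl
    ... | inj₂ y≡ rewrite y≡ = n≤1+n _

  numPaths-source-sink : ∀ {i j} → i < k → (j<k : j < k) →
    numPaths conv tiles (node i 0) (node j (suc (ℓ j))) ≡ PathsToSink.Φ j j<k (i , 0)
  numPaths-source-sink {i} {j} i<k j<k = begin
    countPaths (arrows conv tiles) (length (vertices conv tiles)) [] (node i 0) (node j (suc (ℓ j)))
      ≡⟨ cong (λ as → countPaths as (length (vertices conv tiles)) [] (node i 0) (node j (suc (ℓ j)))) arrows-embedded ⟩
    countPaths embeddedArcs (length (vertices conv tiles)) [] (nodeAt (i , 0)) (nodeAt sink)
      ≡⟨ countPaths-embed sink (length (vertices conv tiles)) (i , 0) [] (valid-source i<k) (valid-sink j<k) [] ⟩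
    paths sink (length (vertices conv tiles)) (i , 0)
      ≡⟨ paths-solution sink Φ Φ-sink Φ-out top sources-below (length (vertices conv tiles)) (i , 0) (valid-source i<k)
           (≤-trans (m∸n≤m top (X i + 0)) length-vertices) ⟩
    Φ (i , 0) ∎
    where
    open ≡-Reasoning
    open PathsToSink j j<k

map-allFin : ∀ {A : Set} n (F : Fin n → A) (G : ℕ → A) → (∀ r → F r ≡ G (toℕ r)) → map F (allFin n) ≡ applyUpTo G n
map-allFin n F G F≡G = trans (map-tabulate (λ x → x) F) (tabulate≡ n F G F≡G)
  where
  tabulate≡ : ∀ {A : Set} n (F : Fin n → A) (G : ℕ → A) → (∀ r → F r ≡ G (toℕ r)) → tabulate F ≡ applyUpTo G n
  tabulate≡ zero F G _ = refl
  tabulate≡ (suc n) F G F≡G = cong₂ _∷_ (F≡G fzero) (tabulate≡ n (F ∘ fsuc) (G ∘ suc) (F≡G ∘ fsuc))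

lookup₀-map-allFin : ∀ {n} (l : Fin n → ℕ) (r : Fin n) → lookup₀ (map l (allFin n)) (toℕ r) ≡ l r
lookup₀-map-allFin {n} l r = trans (cong (λ xs → lookup₀ xs (toℕ r)) (map-tabulate (λ x → x) l)) (lookup₀-tabulate n l r)
  where
  lookup₀-tabulate : ∀ n (g : Fin n → ℕ) (r : Fin n) → lookup₀ (tabulate g) (toℕ r) ≡ g r
  lookup₀-tabulate (suc n) g fzero = refl
  lookup₀-tabulate (suc n) g (fsuc r) = lookup₀-tabulate n (g ∘ fsuc) r

length-map-allFin : ∀ n (l : Fin n → ℕ) → length (map l (allFin n)) ≡ n
length-map-allFin n l = trans (length-map l (allFin n)) (length-tabulate (λ x → x))

All-map-allFin : ∀ {P : ℕ → Set} n (l : Fin n → ℕ) → (∀ r → P (l r)) → All P (map l (allFin n))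
All-map-allFin {P} n l P-l = subst (All P) (sym (map-tabulate (λ x → x) l)) (All-tabulate n l P-l)
  where
  All-tabulate : ∀ n (F : Fin n → ℕ) → (∀ r → P (F r)) → All P (tabulate F)
  All-tabulate zero F _ = []
  All-tabulate (suc n) F P-F = P-F fzero ∷ All-tabulate n (F ∘ fsuc) (P-F ∘ fsuc)

filterᵇ-between : ∀ a b n → a < b → b ≤ n →
  filterᵇ (λ s → (a <ᵇ s) ∧ (s <ᵇ b)) (applyUpTo (λ s → s) n) ≡ applyUpTo (suc a +_) (b ∸ suc a)
filterᵇ-between a b n a<b b≤n with m≤n⇒∃[o]m+o≡n a<b | m≤n⇒∃[o]m+o≡n b≤n
... | m , refl | o , refl = begin
  filterᵇ q (applyUpTo (λ s → s) (suc a + m + o))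
    ≡⟨ cong (filterᵇ q) (trans (applyUpTo-+ (λ s → s) (suc a + m) o) (cong (_++ applyUpTo (suc a + m +_) o) (applyUpTo-+ (λ s → s) (suc a) m))) ⟩
  filterᵇ q ((applyUpTo (λ s → s) (suc a) ++ applyUpTo (suc a +_) m) ++ applyUpTo (suc a + m +_) o)
    ≡⟨ trans (filterᵇ-++ q (applyUpTo (λ s → s) (suc a) ++ applyUpTo (suc a +_) m) (applyUpTo (suc a + m +_) o))
             (cong (_++ filterᵇ q (applyUpTo (suc a + m +_) o)) (filterᵇ-++ q (applyUpTo (λ s → s) (suc a)) (applyUpTo (suc a +_) m))) ⟩
  (filterᵇ q (applyUpTo (λ s → s) (suc a)) ++ filterᵇ q (applyUpTo (suc a +_) m)) ++ filterᵇ q (applyUpTo (suc a + m +_) o)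
    ≡⟨ cong₂ _++_ (cong₂ _++_ (filterᵇ-none q (applyUpTo (λ s → s) (suc a)) (All-applyUpTo (λ s → s) (suc a) below))
                              (filterᵇ-all q (applyUpTo (suc a +_) m) (All-applyUpTo (suc a +_) m inside)))
                  (filterᵇ-none q (applyUpTo (suc a + m +_) o) (All-applyUpTo (suc a + m +_) o (λ s _ → above s))) ⟩
  applyUpTo (suc a +_) m ++ []
    ≡⟨ ++-identityʳ _ ⟩
  applyUpTo (suc a +_) m
    ≡⟨ cong (applyUpTo (suc a +_)) (m+n∸m≡n (suc a) m) ⟨
  applyUpTo (suc a +_) (suc a + m ∸ suc a) ∎
  where
  open ≡-Reasoning
  q : ℕ → Bool
  q s = (a <ᵇ s) ∧ (s <ᵇ suc a + m)
  below : ∀ s → s < suc a → q s ≡ false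
  below s s<1+a rewrite <ᵇ-false {a} {s} (λ a<s → <-irrefl refl (≤-trans a<s (≤-pred s<1+a))) = refl
  inside : ∀ s → s < m → q (suc a + s) ≡ true
  inside s s<m rewrite <ᵇ-true {a} {suc a + s} (s≤s (m≤m+n a s)) | <ᵇ-true {suc a + s} {suc a + m} (+-monoʳ-< (suc a) s<m) = refl
  above : ∀ s → q (suc a + m + s) ≡ false
  above s rewrite <ᵇ-false {suc a + m + s} {suc a + m} (λ lt → <-irrefl refl (≤-trans lt (m≤m+n (suc a + m) s))) with a <ᵇ suc a + m + s
  ... | true = refl
  ... | false = refl

module HourglassFin (k : ℕ) (1≤k : 1 ≤ k) (l : Fin k → ℕ) (l≥2 : ∀ r → 2 ≤ l r) (conv : Convention)
  (compatible : HourglassCompatible conv (hourglassChains k l)) where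

  Ls : List ℕ
  Ls = map l (allFin k)

  length-Ls : length Ls ≡ k
  length-Ls = length-map-allFin k l

  private
    toFin : ∀ {r} → r < length Ls → Fin k
    toFin {r} r<k = fromℕ< (subst (r <_) length-Ls r<k)

    lookup₀≥2 : ∀ {r} → r < length Ls → 2 ≤ lookup₀ Ls r
    lookup₀≥2 r<k = subst (2 ≤_) (trans (sym (lookup₀-map-allFin l (toFin r<k))) (cong (lookup₀ Ls) (toℕ-fromℕ< _))) (l≥2 (toFin r<k))

    all≥1 : All (1 ≤_) Ls
    all≥1 = All-map-allFin k l (λ r → ≤-trans (s≤s z≤n) (l≥2 r))

  open HourglassSnake conv Ls (subst (1 ≤_) (sym length-Ls) 1≤k) lookup₀≥2
    (λ r 1+r<k → compatible _ (steps-hourglass-up Ls all≥1 r 1+r<k)) public hiding (k)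

  snakeTiles-tiles : snakeTiles (hourglassChains k l) ≡ tiles
  snakeTiles-tiles = snakeTiles-hourglass Ls (subst (1 ≤_) (sym length-Ls) 1≤k) all≥1

  toℕ<k : ∀ (i : Fin k) → toℕ i < length Ls
  toℕ<k i = subst (toℕ i <_) (sym length-Ls) (toℕ<n i)

  ℓ-toℕ : ∀ (i : Fin k) → ℓ (toℕ i) ≡ l i
  ℓ-toℕ = lookup₀-map-allFin l

  product-between : ∀ (i j : Fin k) → toℕ i < toℕ j →
    product (map (λ r → fib (l r)) (filter (λ r → (toℕ i <ᵇ toℕ r) ∧ (toℕ r <ᵇ toℕ j) ≟ᴮ true) (allFin k))) ≡ between (toℕ i) (toℕ j)
  product-between i j i<j = cong product (begin
    map (λ r → fib (l r)) (filter (λ r → q (toℕ r) ≟ᴮ true) (allFin k))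
      ≡⟨ cong (map (λ r → fib (l r))) (filter-does (λ r → q (toℕ r) ≟ᴮ true) (q ∘ toℕ) (λ r → does-≟true (q (toℕ r))) (allFin k)) ⟩
    map (λ r → fib (l r)) (filterᵇ (q ∘ toℕ) (allFin k))
      ≡⟨ trans (map-cong (λ r → cong fib (sym (ℓ-toℕ r))) _) (map-∘ (filterᵇ (q ∘ toℕ) (allFin k))) ⟩
    map (fib ∘ ℓ) (map toℕ (filterᵇ (q ∘ toℕ) (allFin k)))
      ≡⟨ cong (map (fib ∘ ℓ)) (filterᵇ-map q toℕ (allFin k)) ⟨
    map (fib ∘ ℓ) (filterᵇ q (map toℕ (allFin k)))
      ≡⟨ cong (λ rs → map (fib ∘ ℓ) (filterᵇ q rs)) (map-allFin k toℕ (λ s → s) (λ _ → refl)) ⟩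
    map (fib ∘ ℓ) (filterᵇ q (applyUpTo (λ s → s) k))
      ≡⟨ cong (map (fib ∘ ℓ)) (filterᵇ-between (toℕ i) (toℕ j) k i<j (<⇒≤ (toℕ<n j))) ⟩
    map (fib ∘ ℓ) (applyUpTo (suc (toℕ i) +_) (toℕ j ∸ suc (toℕ i)))
      ≡⟨ map-applyUpTo _ (fib ∘ ℓ) _ ⟩
    applyUpTo (λ s → fib (ℓ (suc (toℕ i) + s))) (toℕ j ∸ suc (toℕ i)) ∎)
    where
    open ≡-Reasoning
    q : ℕ → Bool
    q s = (toℕ i <ᵇ s) ∧ (s <ᵇ toℕ j)
    does-≟true : ∀ b → does (b ≟ᴮ true) ≡ b
    does-≟true true = refl
    does-≟true false = refl

  pathCount-entry : ∀ (i j : Fin k) → PathsToSink.Φ (toℕ j) (toℕ<k j) (toℕ i , 0) ≡ expectedEntry k l i j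
  pathCount-entry i j with toℕ i <ᵇ toℕ j in i<j
  ... | true = begin
    fib (suc (ℓ (toℕ i))) * (between (toℕ i) (toℕ j) * fib (suc (ℓ (toℕ j))))
      ≡⟨ cong₂ (λ a b → fib (suc a) * (between (toℕ i) (toℕ j) * fib (suc b))) (ℓ-toℕ i) (ℓ-toℕ j) ⟩
    fib (suc (l i)) * (between (toℕ i) (toℕ j) * fib (suc (l j)))
      ≡⟨ regroup (fib (suc (l i))) (between (toℕ i) (toℕ j)) (fib (suc (l j))) ⟩
    fib (suc (l i)) * fib (suc (l j)) * between (toℕ i) (toℕ j)
      ≡⟨ cong₂ (λ a b → fib a * fib b * between (toℕ i) (toℕ j)) (+-comm 1 (l i)) (+-comm 1 (l j)) ⟩
    fib (l i + 1) * fib (l j + 1) * between (toℕ i) (toℕ j)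
      ≡⟨ cong (fib (l i + 1) * fib (l j + 1) *_) (product-between i j (<ᵇ-sound i<j)) ⟨
    fib (l i + 1) * fib (l j + 1) * product (map (λ r → fib (l r)) (filter (λ r → (toℕ i <ᵇ toℕ r) ∧ (toℕ r <ᵇ toℕ j) ≟ᴮ true) (allFin k))) ∎
    where
    open ≡-Reasoning
    regroup : ∀ a b c → a * (b * c) ≡ a * c * b
    regroup = solve-∀
  ... | false with toℕ i ≡ᵇ toℕ j in i≡j
  ...   | true = cong fib (trans (cong (suc ∘ suc) (trans (cong ℓ (sym (≡ᵇ-sound i≡j))) (ℓ-toℕ i))) (+-comm 2 (l i)))
  ...   | false with toℕ i ≡ᵇ suc (toℕ j)
  ...     | true = refl
  ...     | false = refl

proposition4p13 : (k : ℕ) → 1 ≤ k → (l : Fin k → ℕ) → (∀ r → 2 ≤ l r) →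
    (conv : Convention) → HourglassCompatible conv (hourglassChains k l) →
    pathMatrix conv (snakeTiles (hourglassChains k l)) ≡ expectedMatrix k l
proposition4p13 k 1≤k l l≥2 conv compatible = begin
  pathMatrix conv (snakeTiles (hourglassChains k l))
    ≡⟨ cong (pathMatrix conv) snakeTiles-tiles ⟩
  map (λ s → map (numPaths conv tiles s) (sinks conv tiles)) (sources conv tiles)
    ≡⟨ cong₂ (λ ss ts → map (λ s → map (numPaths conv tiles s) ts) ss)
             (trans sources-nodes (cong (applyUpTo _) length-Ls)) (trans sinks-nodes (cong (applyUpTo _) length-Ls)) ⟩
  map (λ s → map (numPaths conv tiles s) (applyUpTo (λ j → node j (suc (ℓ j))) k)) (applyUpTo (λ i → node i 0) k)
    ≡⟨ trans (map-applyUpTo _ _ k) (applyUpTo-cong k (λ _ _ → map-applyUpTo _ _ k)) ⟩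
  applyUpTo (λ i → applyUpTo (λ j → numPaths conv tiles (node i 0) (node j (suc (ℓ j)))) k) k
    ≡⟨ map-allFin k _ _ (λ i → map-allFin k _ _ (λ j →
         sym (trans (numPaths-source-sink (toℕ<k i) (toℕ<k j)) (pathCount-entry i j)))) ⟨
  expectedMatrix k l ∎
  where
  open ≡-Reasoning
  open HourglassFin k 1≤k l l≥2 conv compatible
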